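{- Let $K_n$ be the complete graph with $n$ vertices, where $n\geq 2$. Then \[P_{K_n}^{\times}(z)=\begin{cases} z^{n}+\sum_{i=1}^{n}\binom{n}{n+1-i}z^{i}, & \text{if } n \text{ is even},\\[2pt] z^{n-1}+\sum_{i=1}^{n}\binom{n}{n+1-i}z^{i}, & \text{if } n \text{ is odd}.\end{cases}\]
   Context: A ribbon graph $G$ is a surface with boundary formed from vertex discs and edge discs (ribbons), each edge attached to vertex discs along two disjoint arcs; $v,e,f,c$ denote numbers of vertices, edges, boundary components and connected components, and the Euler genus is $\varepsilon=2c-v+e-f$. For $A\subseteq E(G)$, the partial Petrial $G^{\times|A}$ is obtained by adding a half-twist to each edge in $A$, and ${^\partial\varepsilon^{\times}_{G}(z)}=\sum_{A\subseteq E(G)} z^{\varepsilon(G^{\times|A})}$. A bouquet is a ribbon graph with one vertex; two loops are interlaced if their ends alternate around the vertex boundary; the intersection graph $I(B)$ has vertex set $E(B)$ with adjacency meaning interlaced. A circle graph is a graph $I(B)$ for some bouquet $B$, and for a circle graph $G$, $P_G^{\times}(z):={^\partial\varepsilon^{\times}_{B}(z)}$ for any bouquet $B$ with $I(B)=G$ (independent of the choice of $B$). -}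

module Defs where

open import Data.Nat using (ℕ; zero; suc; _+_; _*_; _∸_; _≤_; _<_; _≤?_; _<?_; _≥?_)
open import Data.Nat.DivMod using (_mod_; _/_; _%_)
open import Data.Nat.Combinatorics using (_C_)
import Data.Nat as ℕ
open import Data.Fin using (Fin; toℕ) renaming (_≟_ to _≟ᶠ_)
open import Data.Bool using (Bool; true; false; not; if_then_else_; _xor_)
open import Data.List using (List; []; _∷_; length; filter; map; _++_; allFin; upTo)
open import Data.Bool.ListAction using (and)
open import Data.Vec using (Vec; lookup) renaming ([] to []ᵥ; _∷_ to _∷ᵥ_)
open import Data.Product using (_×_; _,_; ∃; Σ-syntax)
open import Data.Sum using (_⊎_)
open import Relation.Nullary using (¬?; ⌊_⌋)
open import Relation.Nullary.Decidable using (_×-dec_)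
open import Relation.Binary.PropositionalEquality using (_≡_)

-- The boundary of the single vertex disc is read counterclockwise from a
-- base point; it meets 2m edge-ends at positions 0,…,2m-1.  'word p' is
-- the loop whose end sits at position p (each loop occurs exactly twice),
-- and 'twist e' records whether the ribbon of loop e carries a half-twist.

record Bouquet (m : ℕ) : Set where
  field
    word  : Fin (2 * m) → Fin m
    twist : Fin m → Bool
    twice : ∀ (e : Fin m) →
            length (filter (λ p → word p ≟ᶠ e) (allFin (2 * m))) ≡ 2
open Bouquet public

Interlaced : ∀ {m} → Bouquet m → Fin m → Fin m → Set
Interlaced {m} B e f =
  ∃ λ (p₁ : Fin (2 * m)) → ∃ λ (q₁ : Fin (2 * m)) →
  ∃ λ (p₂ : Fin (2 * m)) → ∃ λ (q₂ : Fin (2 * m)) →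
    (toℕ p₁ < toℕ q₁) × (toℕ q₁ < toℕ p₂) × (toℕ p₂ < toℕ q₂) ×
    ((word B p₁ ≡ e × word B p₂ ≡ e × word B q₁ ≡ f × word B q₂ ≡ f)
     ⊎ (word B p₁ ≡ f × word B p₂ ≡ f × word B q₁ ≡ e × word B q₂ ≡ e))

IntersectionGraphComplete : ∀ {m} → Bouquet m → Set
IntersectionGraphComplete {m} B = ∀ (e f : Fin m) → ¬ (e ≡ f) → Interlaced B e f
  where open import Relation.Nullary using (¬_)

-- Each edge-end at position p is an arc of the
-- vertex boundary from the point (p , false) to the point (p , true)
-- (counterclockwise).  The remaining vertex boundary joins (p , true) to
-- (p+1 , false) (cyclically).  The ribbon of a loop with ends at p and p'
-- joins (p , s) to (p' , not s) if untwisted and to (p' , s) if twisted.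
-- The boundary of the ribbon graph is the union of these two perfect
-- matchings on the 4m points; each boundary component is an alternating
-- cycle, which splits into exactly two orbits of the composite
-- permutation  corner ∘ ribbon.  Hence f = (#orbits) / 2.

nextF : ∀ {n} → Fin n → Fin n
nextF {suc n} i = (suc (toℕ i)) mod (suc n)

prevF : ∀ {n} → Fin n → Fin n
prevF {suc n} i = (toℕ i + n) mod (suc n)

Pt : ℕ → Set
Pt m = Fin (2 * m) × Bool

cornerMatch : ∀ {m} → Pt m → Pt m
cornerMatch (p , true)  = (nextF p , false)
cornerMatch (p , false) = (prevF p , true)

partner : ∀ {m} → Bouquet m → Fin (2 * m) → Fin (2 * m)
partner {m} B p with filter (λ q → ¬? (q ≟ᶠ p) ×-dec (word B q ≟ᶠ word B p)) (allFin (2 * m))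
... | []    = p
... | q ∷ _ = q

ribbonMatch : ∀ {m} → Bouquet m → (Fin m → Bool) → Pt m → Pt m
ribbonMatch B t (p , s) =
  (partner B p , (if t (word B p) then s else not s))

iter : ∀ {A : Set} → ℕ → (A → A) → A → A
iter zero    g x = x
iter (suc j) g x = g (iter j g x)

code : ∀ {m} → Pt m → ℕ
code (p , false) = 2 * toℕ p
code (p , true)  = 2 * toℕ p + 1

allPts : ∀ m → List (Pt m)
allPts m = Data.List.concatMap (λ p → (p , false) ∷ (p , true) ∷ []) (allFin (2 * m))
  where import Data.List

faces : ∀ {m} → Bouquet m → (Fin m → Bool) → ℕ
faces {m} B t = orbits / 2
  where
  φ : Pt m → Pt m
  φ x = cornerMatch {m} (ribbonMatch {m} B t x)
  isOrbitMin : Pt m → Bool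
  isOrbitMin x = and (map (λ j → ⌊ code {m} x ℕ.≤? code {m} (iter j φ x) ⌋) (upTo (4 * m)))
  orbits : ℕ
  orbits = length (filter (λ x → isOrbitMin x Data.Bool.≟ true) (allPts m))
    where import Data.Bool

-- Euler genus  ε = 2c - v + e - f  with c = 1, v = 1, e = m
eulerGenus : ∀ {m} → Bouquet m → (Fin m → Bool) → ℕ
eulerGenus {m} B t = (2 * 1 + m) ∸ (1 + faces B t)

-- Partial Petrials and the partial-Petrial polynomial.
-- A ⊆ E(B) is a Boolean vector; B^{×|A} adds a half-twist to each edge
-- of A, i.e. toggles its twist.

allSubsets : ∀ m → List (Vec Bool m)
allSubsets zero    = []ᵥ ∷ []
allSubsets (suc m) =
  map (true ∷ᵥ_) (allSubsets m) ++ map (false ∷ᵥ_) (allSubsets m)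

petrialTwist : ∀ {m} → Bouquet m → Vec Bool m → Fin m → Bool
petrialTwist B A e = twist B e xor lookup A e

-- coefficient of z^k in  ∂ε^×_B(z) = Σ_{A ⊆ E(B)} z^{ε(B^{×|A})}
partialPetrialCoeff : ∀ {m} → Bouquet m → ℕ → ℕ
partialPetrialCoeff {m} B k =
  length (filter (λ A → eulerGenus B (petrialTwist B A) ℕ.≟ k) (allSubsets m))

indicator : ℕ → ℕ → ℕ
indicator a b = if ⌊ a ℕ.≟ b ⌋ then 1 else 0

rhsCoeff : ℕ → ℕ → ℕ
rhsCoeff n k =
  (if ⌊ n % 2 ℕ.≟ 0 ⌋ then indicator k n else indicator k (n ∸ 1))
  + (if ⌊ 1 ℕ.≤? k ⌋ ∧ ⌊ k ℕ.≤? n ⌋ then n C (n + 1 ∸ k) else 0)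
  where open import Data.Bool using (_∧_)

-- A bouquet whose intersection graph is complete has the two ends of every loop n
-- positions apart, since every other loop has exactly one end strictly between them.
-- Faces are counted as half the number of orbits of the face permutation φ on the 4n
-- corners. Crossing a loop moves a corner n positions along the vertex; the next corner
-- step moves one position further on one side and one position back on the other, and
-- a half-twist on the loop exchanges the two sides. If k ≥ 1 loops are twisted, an
-- orbit started at a twisted end walks forward to the next twisted loop and back, so
-- every orbit contains exactly one of the 2k true-side corners of twisted loops: k faces.
-- If no loop is twisted, φ translates by n + 1 and n − 1; these are units modulo d,
-- with d = n for odd n and d = 2n for even n, and the orbits are the residue classes
-- modulo d: 2 faces for odd n, 1 for even n. Finally a partial Petrial has c twisted
-- loops for exactly binomial(n, c) subsets A.

module Submission where

open import Defs
open import Data.Nat using (ℕ; _≤_)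
open import Relation.Binary.PropositionalEquality using (_≡_)

open import Data.Bool using (Bool; true; false; not; _∧_; _xor_; if_then_else_)
import Data.Bool as Bool
open import Data.Bool.ListAction using (and)
open import Data.Bool.Properties using (∧-zeroʳ; ∧-identityʳ; ∧-comm; not-involutive)
open import Data.Fin using (Fin; toℕ; zero; suc)
import Data.Fin.Properties as Fin
import Data.List
open import Data.List using (List; []; _∷_; _++_; map; length; filter; allFin; upTo; applyUpTo)
open import Data.List.Membership.Propositional using (lose)
open import Data.List.Membership.Propositional.Properties using (∈-allFin)
open import Data.List.Properties using (filter-some; map-cong; map-++; map-∘; map-tabulate; map-upTo; length-tabulate)
open import Data.List.Relation.Unary.All using (_∷_)
open import Data.List.Relation.Unary.All.Properties using (all-filter)
open import Data.Nat using (zero; suc; _+_; _*_; _∸_; _<_; _≟_; _≤?_; _<?_; _<ᵇ_; z≤n; s≤s; z<s; NonZero; >-nonZero)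
open import Data.Nat.Combinatorics using (_C_; nCk+nC[k+1]≡[n+1]C[k+1]; k>n⇒nCk≡0)
open import Data.Nat.DivMod using (_%_; _/_; _mod_; m*n/n≡m; m≡m%n+[m/n]*n; m%n<n; m<n⇒m%n≡m; [m+kn]%n≡m%n)
open import Data.Nat.Divisibility using (_∣_; divides; _∣?_; ∣-refl; _∣0; >⇒∤; ∣⇒≤; n∣m*n; m∣m*n)
open import Data.Nat.Divisibility using (∣m+n∣m⇒∣n; ∣m∣n⇒∣m+n; ∣m⇒∣m*n; ∣n∣m%n⇒∣m; %-presˡ-∣)
open import Data.Nat.ListAction using (sum)
open import Data.Nat.ListAction.Properties using (sum-++)
open import Data.Nat.Properties
open import Data.Nat.Solver using (module +-*-Solver)
open import Data.Product using (_×_; _,_; ∃; ∃₂; proj₁; proj₂; uncurry)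
open import Data.Product.Properties using (,-injective)
open import Data.Sum using (_⊎_; inj₁; inj₂; [_,_])
open import Data.Vec using (Vec; lookup) renaming (_∷_ to _∷ᵥ_)
open import Function using (_∘_; id; _⇔_; mk⇔)
open import Relation.Binary.Definitions using (DecidableEquality; tri<; tri≈; tri>)
open import Relation.Binary.PropositionalEquality using (refl; sym; trans; cong; cong₂; subst; _≢_; _≗_; module ≡-Reasoning)
open import Relation.Nullary using (Dec; yes; no; does; ¬_; ¬?; contradiction; ⌊_⌋)
open import Relation.Nullary.Decidable using (dec-true; dec-false; isYes≗does; does-⇔; map′; _×-dec_)
open import Relation.Unary using (Decidable)
open import Algebra.Properties.CommutativeSemigroup +-commutativeSemigroup using (interchange)

open +-*-Solver

-- Counting

bit : Bool → ℕ
bit false = 0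
bit true  = 1

count : {A : Set} → (A → Bool) → List A → ℕ
count P xs = sum (map (bit ∘ P) xs)

witness : {P : Set} (P? : Dec P) → does P? ≡ true → P
witness (yes p) _ = p

∧-true⁻ : ∀ {a b} → a ∧ b ≡ true → a ≡ true × b ≡ true
∧-true⁻ {true} b≡true = refl , b≡true

module _ {A : Set} where

  length-filter≡count : {P : A → Set} (P? : Decidable P) (xs : List A) →
                        length (filter P? xs) ≡ count (does ∘ P?) xs
  length-filter≡count P? [] = refl
  length-filter≡count P? (x ∷ xs) with does (P? x)
  ... | true  = cong suc (length-filter≡count P? xs)
  ... | false = length-filter≡count P? xs

  sum-map-cong : {f g : A → ℕ} → f ≗ g → ∀ xs → sum (map f xs) ≡ sum (map g xs)
  sum-map-cong f≗g xs = cong sum (map-cong f≗g xs)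

  sum-map-+ : (f g : A → ℕ) (xs : List A) →
              sum (map (λ x → f x + g x) xs) ≡ sum (map f xs) + sum (map g xs)
  sum-map-+ f g [] = refl
  sum-map-+ f g (x ∷ xs) =
    trans (cong (f x + g x +_) (sum-map-+ f g xs)) (interchange (f x) (g x) (sum (map f xs)) _)

  sum-map-*ʳ : (f : A → ℕ) (c : ℕ) (xs : List A) → sum (map (λ x → f x * c) xs) ≡ sum (map f xs) * c
  sum-map-*ʳ f c [] = refl
  sum-map-*ʳ f c (x ∷ xs) = trans (cong (f x * c +_) (sum-map-*ʳ f c xs)) (sym (*-distribʳ-+ c (f x) _))

  count-cong : {P Q : A → Bool} → P ≗ Q → ∀ xs → count P xs ≡ count Q xs
  count-cong P≗Q = sum-map-cong (cong bit ∘ P≗Q)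

  count-map : {B : Set} (P : B → Bool) (f : A → B) (xs : List A) → count P (map f xs) ≡ count (P ∘ f) xs
  count-map P f xs = cong sum (sym (map-∘ xs))

  count-true : (xs : List A) → count (λ _ → true) xs ≡ length xs
  count-true [] = refl
  count-true (x ∷ xs) = cong suc (count-true xs)

  count-none : {P : A → Bool} → (∀ x → P x ≡ false) → ∀ xs → count P xs ≡ 0
  count-none none [] = refl
  count-none none (x ∷ xs) rewrite none x = count-none none xs

  count-mono : {P Q : A → Bool} → (∀ x → P x ≡ true → Q x ≡ true) → ∀ xs → count P xs ≤ count Q xs
  count-mono P⇒Q [] = z≤n
  count-mono {P} {Q} P⇒Q (x ∷ xs) with P x in Px | Q x in Qx
  ... | false | false = count-mono P⇒Q xs
  ... | false | true  = m≤n⇒m≤1+n (count-mono P⇒Q xs)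
  ... | true  | true  = s≤s (count-mono P⇒Q xs)
  ... | true  | false = contradiction (trans (sym Qx) (P⇒Q x Px)) λ ()

  count-split : (P Q : A → Bool) (xs : List A) →
                count P xs ≡ count (λ x → P x ∧ Q x) xs + count (λ x → P x ∧ not (Q x)) xs
  count-split P Q [] = refl
  count-split P Q (x ∷ xs) with P x | Q x
  ... | false | _     = count-split P Q xs
  ... | true  | true  = cong suc (count-split P Q xs)
  ... | true  | false = trans (cong suc (count-split P Q xs)) (sym (+-suc _ _))

  count-witness : (P : A → Bool) (xs : List A) → 0 < count P xs → ∃ λ x → P x ≡ true
  count-witness P (x ∷ xs) pos with P x in Px
  ... | true  = x , Px
  ... | false = count-witness P xs pos

count-allFin-suc : ∀ n (P : Fin (suc n) → Bool) →
                   count P (allFin (suc n)) ≡ bit (P zero) + count (P ∘ suc) (allFin n)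
count-allFin-suc n P =
  cong (bit (P zero) +_) (trans (cong (count P) (sym (map-tabulate id suc))) (count-map P suc (allFin n)))

count-below : ∀ N b → b ≤ N → count (λ p → toℕ p <ᵇ b) (allFin N) ≡ b
count-below N       zero    _         = count-none (λ _ → refl) (allFin N)
count-below (suc N) (suc b) (s≤s b≤N) =
  trans (count-allFin-suc N (λ p → toℕ p <ᵇ suc b)) (cong suc (count-below N b b≤N))

count-between : ∀ N a b → b ≤ N → count (λ p → (a <ᵇ toℕ p) ∧ (toℕ p <ᵇ b)) (allFin N) ≡ b ∸ suc a
count-between zero    a       b       z≤n       = refl
count-between (suc N) a       zero    _         = count-none (λ p → ∧-zeroʳ (a <ᵇ toℕ p)) (allFin (suc N))
count-between (suc N) zero    (suc b) (s≤s b≤N) =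
  trans (count-allFin-suc N (λ p → (0 <ᵇ toℕ p) ∧ (toℕ p <ᵇ suc b))) (count-below N b b≤N)
count-between (suc N) (suc a) (suc b) (s≤s b≤N) =
  trans (count-allFin-suc N (λ p → (suc a <ᵇ toℕ p) ∧ (toℕ p <ᵇ suc b))) (count-between N a b b≤N)

count-allFin-+ : ∀ a b (P : ℕ → Bool) →
                 count (P ∘ toℕ) (allFin (a + b)) ≡ count (P ∘ toℕ) (allFin a) + count (λ p → P (a + toℕ p)) (allFin b)
count-allFin-+ zero    b P = refl
count-allFin-+ (suc a) b P = begin
  count (P ∘ toℕ) (allFin (suc a + b))
    ≡⟨ count-allFin-suc (a + b) (P ∘ toℕ) ⟩
  bit (P 0) + count (P ∘ suc ∘ toℕ) (allFin (a + b))
    ≡⟨ cong (bit (P 0) +_) (count-allFin-+ a b (P ∘ suc)) ⟩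
  bit (P 0) + (count (P ∘ suc ∘ toℕ) (allFin a) + count (λ p → P (suc a + toℕ p)) (allFin b))
    ≡⟨ +-assoc (bit (P 0)) _ _ ⟨
  bit (P 0) + count (P ∘ suc ∘ toℕ) (allFin a) + count (λ p → P (suc a + toℕ p)) (allFin b)
    ≡⟨ cong (_+ count (λ p → P (suc a + toℕ p)) (allFin b)) (count-allFin-suc a (P ∘ toℕ)) ⟨
  count (P ∘ toℕ) (allFin (suc a)) + count (λ p → P (suc a + toℕ p)) (allFin b) ∎
  where open ≡-Reasoning

count-multiples : ∀ q d .{{_ : NonZero d}} → count (λ p → does (d ∣? toℕ p)) (allFin (q * d)) ≡ q
count-multiples zero    d = refl
count-multiples (suc q) d = begin
  count (λ p → does (d ∣? toℕ p)) (allFin (d + q * d))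
    ≡⟨ count-allFin-+ d (q * d) (λ i → does (d ∣? i)) ⟩
  count (λ p → does (d ∣? toℕ p)) (allFin d) + count (λ p → does (d ∣? d + toℕ p)) (allFin (q * d))
    ≡⟨ cong₂ _+_ (only-zero d)
                 (count-cong (λ p → does-⇔ (d∣d+⇔ (toℕ p)) (d ∣? d + toℕ p) (d ∣? toℕ p)) (allFin (q * d))) ⟩
  1 + count (λ p → does (d ∣? toℕ p)) (allFin (q * d))
    ≡⟨ cong suc (count-multiples q d) ⟩
  suc q ∎
  where
  open ≡-Reasoning
  d∣d+⇔ : ∀ i → d ∣ d + i ⇔ d ∣ i
  d∣d+⇔ i = mk⇔ (λ d∣d+i → ∣m+n∣m⇒∣n d∣d+i ∣-refl) (∣m∣n⇒∣m+n ∣-refl)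
  only-zero : ∀ d → .{{_ : NonZero d}} → count (λ p → does (d ∣? toℕ p)) (allFin d) ≡ 1
  only-zero (suc d) = begin
    count (λ p → does (suc d ∣? toℕ p)) (allFin (suc d))
      ≡⟨ count-allFin-suc d (λ p → does (suc d ∣? toℕ p)) ⟩
    bit (does (suc d ∣? 0)) + count (λ p → does (suc d ∣? suc (toℕ p))) (allFin d)
      ≡⟨ cong₂ _+_ (cong bit (dec-true (suc d ∣? 0) (suc d ∣0)))
                   (count-none (λ p → dec-false (suc d ∣? _) (>⇒∤ (s≤s (Fin.toℕ<n p)))) (allFin d)) ⟩
    1 ∎

module Enumeration {A : Set} (_≟_ : DecidableEquality A) where

  infix 4 _==_
  _==_ : A → A → Bool
  x == y = does (x ≟ y)

  ==-refl : ∀ x → (x == x) ≡ true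
  ==-refl x = dec-true (x ≟ x) refl

  ==⇒≡ : ∀ {x y} → (x == y) ≡ true → x ≡ y
  ==⇒≡ {x} {y} = witness (x ≟ y)

  record Enumerates (xs : List A) : Set where
    field once : ∀ x → count (x ==_) xs ≡ 1
  open Enumerates public

  module _ {xs : List A} (enum : Enumerates xs) where

    count-unique : {P : A → Bool} {c : A} → P c ≡ true → (∀ y → P y ≡ true → y ≡ c) → count P xs ≡ 1
    count-unique {P} {c} Pc unique = trans (count-cong P≗[c==] xs) (once enum c)
      where
      P≗[c==] : ∀ y → P y ≡ (c == y)
      P≗[c==] y with P y in Py | c ≟ y
      ... | true  | yes _    = refl
      ... | true  | no c≢y   = contradiction (sym (unique y Py)) c≢y
      ... | false | yes refl = trans (sym Py) Pc
      ... | false | no _     = refl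

    count-pos : {P : A → Bool} {c : A} → P c ≡ true → 0 < count P xs
    count-pos {P} {c} Pc = subst (_≤ count P xs) (once enum c) (count-mono c==⇒P xs)
      where
      c==⇒P : ∀ y → (c == y) ≡ true → P y ≡ true
      c==⇒P y c==y rewrite ==⇒≡ c==y = Pc

    count≡0⇒false : {P : A → Bool} → count P xs ≡ 0 → ∀ x → P x ≡ false
    count≡0⇒false {P} P≡0 x with P x in Px
    ... | true  = contradiction (subst (0 <_) P≡0 (count-pos Px)) λ ()
    ... | false = refl

    count-remove : {P : A → Bool} {k : ℕ} {a : A} → count P xs ≡ suc k → P a ≡ true →
                   count (λ y → P y ∧ not (a == y)) xs ≡ k
    count-remove {P} {k} {a} P≡1+k Pa = suc-injective (begin
      suc (count (λ y → P y ∧ not (a == y)) xs)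
        ≡⟨ cong (_+ count (λ y → P y ∧ not (a == y)) xs) a-once ⟨
      count (λ y → P y ∧ (a == y)) xs + count (λ y → P y ∧ not (a == y)) xs
        ≡⟨ count-split P (a ==_) xs ⟨
      count P xs
        ≡⟨ P≡1+k ⟩
      suc k ∎)
      where
      open ≡-Reasoning
      a-once : count (λ y → P y ∧ (a == y)) xs ≡ 1
      a-once = count-unique (trans (cong (_∧ (a == a)) Pa) (==-refl a)) (λ y h → sym (==⇒≡ (proj₂ (∧-true⁻ h))))

    count≡1⇒unique : {P : A → Bool} {a x : A} → count P xs ≡ 1 → P a ≡ true → P x ≡ true → x ≡ a
    count≡1⇒unique {P} {a} {x} P≡1 Pa Px with a ≟ x
    ... | yes a≡x = sym a≡x
    ... | no a≢x  = contradiction (subst (0 <_) (count-remove P≡1 Pa) (count-pos Px∧x≢a)) λ ()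
      where
      Px∧x≢a : P x ∧ not (a == x) ≡ true
      Px∧x≢a rewrite Px | dec-false (a ≟ x) a≢x = refl

    count≡2⇒other : {P : A → Bool} {a : A} → count P xs ≡ 2 → P a ≡ true → ∃ λ b → b ≢ a × P b ≡ true
    count≡2⇒other {P} {a} P≡2 Pa with count-witness _ xs (subst (0 <_) (sym (count-remove P≡2 Pa)) z<s)
    ... | b , Pb∧b≢a with P b in Pb | a ≟ b | Pb∧b≢a
    ...   | true | no a≢b | _ = b , (λ b≡a → a≢b (sym b≡a)) , Pb
    ...   | true | yes _  | ()
    ...   | false | _     | ()

    count≡2⇒either : {P : A → Bool} {a b x : A} → count P xs ≡ 2 → P a ≡ true → P b ≡ true → a ≢ b →
                      P x ≡ true → x ≡ a ⊎ x ≡ b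
    count≡2⇒either {P} {a} {b} {x} P≡2 Pa Pb a≢b Px with a ≟ x
    ... | yes a≡x = inj₁ (sym a≡x)
    ... | no a≢x  = inj₂ (count≡1⇒unique (count-remove P≡2 Pa) (without-a b a≢b Pb) (without-a x a≢x Px))
      where
      without-a : ∀ y → a ≢ y → P y ≡ true → P y ∧ not (a == y) ≡ true
      without-a y a≢y Py rewrite Py | dec-false (a ≟ y) a≢y = refl

    count≡2-split : {P Q : A → Bool} {a b : A} → count P xs ≡ 2 →
                    P a ∧ Q a ≡ true → P b ∧ not (Q b) ≡ true → count (λ y → P y ∧ Q y) xs ≡ 1
    count≡2-split {P} {Q} P≡2 PQa PQ̸b =
      halves (count-pos PQa) (count-pos PQ̸b) (trans (sym (count-split P Q xs)) P≡2)
      where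
      halves : ∀ {u v} → 0 < u → 0 < v → u + v ≡ 2 → u ≡ 1
      halves {suc zero} _ _ _ = refl
      halves {suc (suc u)} {suc v} _ _ eq = contradiction (suc-injective (suc-injective eq)) (m+1+n≢0 u)

    count-≢ : (x : A) → count (λ y → not (x == y)) xs ≡ length xs ∸ 1
    count-≢ x = sym (begin
      length xs ∸ 1                                          ≡⟨ cong (_∸ 1) (count-true xs) ⟨
      count (λ _ → true) xs ∸ 1                              ≡⟨ cong (_∸ 1) (count-split (λ _ → true) (x ==_) xs) ⟩
      count (x ==_) xs + count (λ y → not (x == y)) xs ∸ 1
        ≡⟨ cong (λ c → c + count (λ y → not (x == y)) xs ∸ 1) (once enum x) ⟩
      count (λ y → not (x == y)) xs                          ∎)
      where open ≡-Reasoning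

  count-fibres : {B : Set} (P : B → Bool) (g : B → A) {ys : List A} → Enumerates ys → (xs : List B) →
                 count P xs ≡ sum (map (λ y → count (λ x → P x ∧ (g x == y)) xs) ys)
  count-fibres P g {ys} enum [] = sym (count-none (λ _ → refl) ys)
  count-fibres P g {ys} enum (x ∷ xs) = begin
    bit (P x) + count P xs
      ≡⟨ cong₂ _+_ (sym x-in-one-fibre) (count-fibres P g enum xs) ⟩
    count (λ y → P x ∧ (g x == y)) ys + sum (map (λ y → count (λ x → P x ∧ (g x == y)) xs) ys)
      ≡⟨ sum-map-+ _ _ ys ⟨
    sum (map (λ y → count (λ x → P x ∧ (g x == y)) (x ∷ xs)) ys) ∎
    where
    open ≡-Reasoning
    x-in-one-fibre : count (λ y → P x ∧ (g x == y)) ys ≡ bit (P x)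
    x-in-one-fibre with P x
    ... | true  = once enum (g x)
    ... | false = count-none (λ _ → refl) ys

  count-∘ : {B : Set} (P : A → Bool) (g : B → A) {ys : List A} → Enumerates ys → (xs : List B) {c : ℕ} →
            (∀ y → count (λ x → g x == y) xs ≡ c) → count (P ∘ g) xs ≡ count P ys * c
  count-∘ P g {ys} enum xs {c} fibre = begin
    count (P ∘ g) xs                                           ≡⟨ count-fibres (P ∘ g) g enum xs ⟩
    sum (map (λ y → count (λ x → P (g x) ∧ (g x == y)) xs) ys) ≡⟨ sum-map-cong fibre-count ys ⟩
    sum (map (λ y → bit (P y) * c) ys)                         ≡⟨ sum-map-*ʳ (bit ∘ P) c ys ⟩
    count P ys * c                                             ∎
    where
    open ≡-Reasoning
    P∘g-on-fibre : ∀ y x → P (g x) ∧ (g x == y) ≡ P y ∧ (g x == y)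
    P∘g-on-fibre y x with g x ≟ y
    ... | yes gx≡y = cong (_∧ true) (cong P gx≡y)
    ... | no _     = trans (∧-zeroʳ _) (sym (∧-zeroʳ _))
    fibre-count : ∀ y → count (λ x → P (g x) ∧ (g x == y)) xs ≡ bit (P y) * c
    fibre-count y with P y | count-cong (P∘g-on-fibre y) xs
    ... | true  | eq = trans eq (trans (fibre y) (sym (+-identityʳ c)))
    ... | false | eq = trans eq (count-none (λ _ → refl) xs)

allFin-enumerates : ∀ n → Enumeration.Enumerates Fin._≟_ (allFin n)
allFin-enumerates n = record { once = once-allFin n }
  where
  once-allFin : ∀ n (c : Fin n) → count (λ y → does (c Fin.≟ y)) (allFin n) ≡ 1
  once-allFin (suc n) zero =
    trans (count-allFin-suc n (λ y → does (zero Fin.≟ y))) (cong suc (count-none (λ _ → refl) (allFin n)))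
  once-allFin (suc n) (suc c) = trans (count-allFin-suc n (λ y → does (suc c Fin.≟ y))) (once-allFin n c)

-- Orbits of a permutation of a finite set

and-applyUpTo⁻ : ∀ (f : ℕ → Bool) n → and (applyUpTo f n) ≡ true → ∀ j → j < n → f j ≡ true
and-applyUpTo⁻ f (suc n) all zero    _         = proj₁ (∧-true⁻ all)
and-applyUpTo⁻ f (suc n) all (suc j) (s≤s j<n) = and-applyUpTo⁻ (f ∘ suc) n (proj₂ (∧-true⁻ all)) j j<n

and-applyUpTo⁺ : ∀ (f : ℕ → Bool) n → (∀ j → j < n → f j ≡ true) → and (applyUpTo f n) ≡ true
and-applyUpTo⁺ f zero    all = refl
and-applyUpTo⁺ f (suc n) all rewrite all 0 z<s = and-applyUpTo⁺ (f ∘ suc) n (λ j j<n → all (suc j) (s≤s j<n))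

∃-least : (P : ℕ → Bool) {a : ℕ} → P a ≡ true →
          ∃ λ b → b ≤ a × P b ≡ true × (∀ c → c < b → P c ≡ false)
∃-least P {zero} P0 = 0 , z≤n , P0 , λ _ ()
∃-least P {suc a} Pa with P 0 in P0
... | true  = 0 , z≤n , P0 , λ _ ()
... | false with ∃-least (P ∘ suc) Pa
...   | b , b≤a , Pb , below = suc b , s≤s b≤a , Pb , below′
  where
  below′ : ∀ c → c < suc b → P c ≡ false
  below′ zero    _         = P0
  below′ (suc c) (s≤s c<b) = below c c<b

∃-argmin : (f : ℕ → ℕ) (n : ℕ) .{{_ : NonZero n}} → ∃ λ i → ∀ j → j < n → f i ≤ f j
∃-argmin f (suc n) = argmin-below-suc n
  where
  argmin-below-suc : ∀ n → ∃ λ i → ∀ j → j < suc n → f i ≤ f j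
  argmin-below-suc zero = 0 , λ { zero _ → ≤-refl ; (suc _) (s≤s ()) }
  argmin-below-suc (suc n) with argmin-below-suc n
  ... | i , i-min with ≤-total (f i) (f (suc n))
  ...   | inj₁ fi≤ = i , λ j j<2+n →
          [ i-min j , (λ { refl → fi≤ }) ] (m<1+n⇒m<n∨m≡n j<2+n)
  ...   | inj₂ f≤fi = suc n , λ j j<2+n →
          [ (λ j<1+n → ≤-trans f≤fi (i-min j j<1+n)) , (λ { refl → ≤-refl }) ] (m<1+n⇒m<n∨m≡n j<2+n)

module _ {X : Set} (f : X → X) where

  iter-+ : ∀ a b x → iter (a + b) f x ≡ iter a f (iter b f x)
  iter-+ zero    b x = refl
  iter-+ (suc a) b x = cong f (iter-+ a b x)

  iter-comm : ∀ a b x → iter a f (iter b f x) ≡ iter b f (iter a f x)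
  iter-comm a b x = trans (sym (iter-+ a b x)) (trans (cong (λ k → iter k f x) (+-comm a b)) (iter-+ b a x))

  iter-injective : (∀ {x y} → f x ≡ f y → x ≡ y) → ∀ a {x y} → iter a f x ≡ iter a f y → x ≡ y
  iter-injective f-injective zero    eq = eq
  iter-injective f-injective (suc a) eq = iter-injective f-injective a (f-injective eq)

  iter-*-period : ∀ {P x} → iter P f x ≡ x → ∀ k → iter (k * P) f x ≡ x
  iter-*-period         per zero    = refl
  iter-*-period {P} {x} per (suc k) = trans (iter-+ P (k * P) x) (trans (cong (iter P f) (iter-*-period per k)) per)

  iter-%-period : ∀ {P x} .{{_ : NonZero P}} → iter P f x ≡ x → ∀ j → iter j f x ≡ iter (j % P) f x
  iter-%-period {P} {x} per j = begin
    iter j f x                              ≡⟨ cong (λ k → iter k f x) (m≡m%n+[m/n]*n j P) ⟩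
    iter (j % P + j / P * P) f x            ≡⟨ iter-+ (j % P) (j / P * P) x ⟩
    iter (j % P) f (iter (j / P * P) f x)   ≡⟨ cong (iter (j % P) f) (iter-*-period per (j / P)) ⟩
    iter (j % P) f x                        ∎
    where open ≡-Reasoning

Reaches : {X : Set} → (X → X) → (X → Bool) → X → Set
Reaches φ R x = ∃ λ a → R (iter a φ x) ≡ true

record FirstReturn {X : Set} (φ : X → X) (R : X → Bool) (L : ℕ) (r : X) : Set where
  field
    period    : ℕ
    period>0  : 0 < period
    2period≤L : 2 * period ≤ L
    periodic  : iter period φ r ≡ r
    avoids    : ∀ i → 0 < i → i < period → R (iter i φ r) ≡ false

-- Every orbit meets R exactly once, at the first entry of any of its points, and has exactly one
-- key-minimal point, which the scan over L steps detects because the period fits twice into L.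
module OrbitCount
  {X : Set} (_≟_ : DecidableEquality X) {xs : List X} (enum : Enumeration.Enumerates _≟_ xs)
  (φ : X → X) (φ-injective : ∀ {x y} → φ x ≡ φ y → x ≡ y)
  (key : X → ℕ) (key-injective : ∀ {x y} → key x ≡ key y → x ≡ y)
  (L : ℕ) (R : X → Bool)
  (reaches : ∀ x → Reaches φ R x) (returns : ∀ r → R r ≡ true → FirstReturn φ R L r)
  where

  open Enumeration _≟_
  open FirstReturn

  isOrbitMin : X → Bool
  isOrbitMin x = and (map (λ j → ⌊ key x ≤? key (iter j φ x) ⌋) (upTo L))

  isOrbitMin⁻ : ∀ {x} → isOrbitMin x ≡ true → ∀ j → j < L → key x ≤ key (iter j φ x)
  isOrbitMin⁻ {x} min j j<L = witness (key x ≤? _) (trans (sym (isYes≗does (key x ≤? _)))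
    (and-applyUpTo⁻ _ L (trans (cong and (sym (map-upTo _ L))) min) j j<L))

  isOrbitMin⁺ : ∀ {x} → (∀ j → key x ≤ key (iter j φ x)) → isOrbitMin x ≡ true
  isOrbitMin⁺ {x} min = trans (cong and (map-upTo _ L))
    (and-applyUpTo⁺ _ L (λ j _ → trans (isYes≗does (key x ≤? _)) (dec-true (key x ≤? _) (min j))))

  private
    first-entry : ∀ x → ∃ λ d → d ≤ proj₁ (reaches x) × R (iter d φ x) ≡ true × (∀ c → c < d → R (iter c φ x) ≡ false)
    first-entry x = ∃-least (λ a → R (iter a φ x)) (proj₂ (reaches x))

  entryTime : X → ℕ
  entryTime x = proj₁ (first-entry x)

  entry : X → X
  entry x = iter (entryTime x) φ x

  entry∈R : ∀ x → R (entry x) ≡ true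
  entry∈R x = proj₁ (proj₂ (proj₂ (first-entry x)))

  before-entry : ∀ x c → c < entryTime x → R (iter c φ x) ≡ false
  before-entry x = proj₂ (proj₂ (proj₂ (first-entry x)))

  periodic-from-entry : ∀ x P → iter P φ (entry x) ≡ entry x → iter P φ x ≡ x
  periodic-from-entry x P per = iter-injective φ φ-injective (entryTime x) (trans (iter-comm φ (entryTime x) P x) per)

  entryTime<period : ∀ x {P} → 0 < P → iter P φ (entry x) ≡ entry x → entryTime x < P
  entryTime<period x {P} P>0 per with entryTime x <? P
  ... | yes d<P = d<P
  ... | no  d≮P = contradiction (trans (sym (before-entry x (d ∸ P) (∸-monoʳ-< P>0 P≤d))) hits) λ ()
    where
    open ≡-Reasoning
    d : ℕ
    d = entryTime x
    P≤d : P ≤ d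
    P≤d = ≮⇒≥ d≮P
    hits : R (iter (d ∸ P) φ x) ≡ true
    hits = subst (λ y → R y ≡ true) (sym (begin
      iter (d ∸ P) φ x               ≡⟨ cong (iter (d ∸ P) φ) (periodic-from-entry x P per) ⟨
      iter (d ∸ P) φ (iter P φ x)    ≡⟨ iter-+ φ (d ∸ P) P x ⟨
      iter (d ∸ P + P) φ x           ≡⟨ cong (λ k → iter k φ x) (m∸n+n≡m P≤d) ⟩
      entry x                        ∎)) (entry∈R x)

  same-entry⇒reachable : ∀ {x y} → entry x ≡ entry y → ∃ λ j → j < L × iter j φ x ≡ y
  same-entry⇒reachable {x} {y} same = P ∸ entryTime y + entryTime x , bound , path
    where
    ret : FirstReturn φ R L (entry y)
    ret = returns (entry y) (entry∈R y)
    P : ℕ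
    P = period ret
    per-y : iter P φ (entry y) ≡ entry y
    per-y = periodic ret
    per-x : iter P φ (entry x) ≡ entry x
    per-x = subst (λ z → iter P φ z ≡ z) (sym same) per-y
    bound : P ∸ entryTime y + entryTime x < L
    bound = <-≤-trans (+-mono-≤-< (m∸n≤m P (entryTime y)) (entryTime<period x (period>0 ret) per-x))
                      (subst (_≤ L) (cong (P +_) (+-identityʳ P)) (2period≤L ret))
    y-from-entry : iter (P ∸ entryTime y) φ (entry y) ≡ y
    y-from-entry = trans (sym (iter-+ φ (P ∸ entryTime y) (entryTime y) y))
      (trans (cong (λ k → iter k φ y) (m∸n+n≡m (<⇒≤ (entryTime<period y (period>0 ret) per-y))))
             (periodic-from-entry y P per-y))
    path : iter (P ∸ entryTime y + entryTime x) φ x ≡ y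
    path = trans (iter-+ φ (P ∸ entryTime y) (entryTime x) x)
                 (trans (cong (iter (P ∸ entryTime y) φ) same) y-from-entry)

  orbitMin-unique : ∀ {x y} → isOrbitMin x ≡ true → isOrbitMin y ≡ true → entry x ≡ entry y → x ≡ y
  orbitMin-unique {x} {y} min-x min-y same
    with same-entry⇒reachable same | same-entry⇒reachable (sym same)
  ... | j , j<L , x→y | k , k<L , y→x = key-injective (≤-antisym
          (subst (λ z → key x ≤ key z) x→y (isOrbitMin⁻ min-x j j<L))
          (subst (λ z → key y ≤ key z) y→x (isOrbitMin⁻ min-y k k<L)))

  orbitMin-exists : ∀ {r} → R r ≡ true → ∃ λ x → isOrbitMin x ≡ true × entry x ≡ r
  orbitMin-exists {r} Rr = x , isOrbitMin⁺ x-min , entry-x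
    where
    ret : FirstReturn φ R L r
    ret = returns r Rr
    P : ℕ
    P = period ret
    instance
      P-nonZero : NonZero P
      P-nonZero = >-nonZero (period>0 ret)
    orbit : ℕ → X
    orbit i = iter i φ r
    i : ℕ
    i = proj₁ (∃-argmin (key ∘ orbit) P)
    x : X
    x = orbit i
    x-iter : ∀ j → iter j φ x ≡ orbit ((j + i) % P)
    x-iter j = trans (sym (iter-+ φ j i r)) (iter-%-period φ (periodic ret) (j + i))
    x-min : ∀ j → key x ≤ key (iter j φ x)
    x-min j = subst (λ z → key x ≤ key z) (sym (x-iter j)) (proj₂ (∃-argmin (key ∘ orbit) P) _ (m%n<n (j + i) P))
    entry-x : entry x ≡ r
    entry-x with (entryTime x + i) % P | m%n<n (entryTime x + i) P | x-iter (entryTime x)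
    ... | zero  | _   | eq = eq
    ... | suc q | q<P | eq =
      contradiction (trans (sym (avoids ret (suc q) z<s q<P)) (subst (λ z → R z ≡ true) eq (entry∈R x))) λ ()

  count-isOrbitMin : count isOrbitMin xs ≡ count R xs
  count-isOrbitMin = trans (count-fibres isOrbitMin entry enum xs) (sum-map-cong one-min-per-orbit xs)
    where
    one-min-per-orbit : ∀ r → count (λ x → isOrbitMin x ∧ (entry x == r)) xs ≡ bit (R r)
    one-min-per-orbit r with R r in Rr
    ... | true with orbitMin-exists Rr
    ...   | x , x-min , entry-x = count-unique enum
            (trans (cong₂ _∧_ x-min (cong (_== r) entry-x)) (==-refl r))
            (λ y y∈ → let y-min , entry-y = ∧-true⁻ y∈ in
                      orbitMin-unique y-min x-min (trans (==⇒≡ entry-y) (sym entry-x)))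
    one-min-per-orbit r | false = count-none not-entered xs
      where
      not-entered : ∀ y → isOrbitMin y ∧ (entry y == r) ≡ false
      not-entered y with entry y ≟ r
      ... | yes entry-y = contradiction (trans (sym Rr) (subst (λ z → R z ≡ true) entry-y (entry∈R y))) λ ()
      ... | no _        = ∧-zeroʳ _

-- Bouquets with complete intersection graph

_≟ᵖ_ : ∀ {k} → DecidableEquality (Pt k)
(p , s) ≟ᵖ (q , b) = map′ (uncurry (cong₂ _,_)) ,-injective ((p Fin.≟ q) ×-dec (s Bool.≟ b))

count-allPts : ∀ k (P : Pt k → Bool) →
               count P (allPts k) ≡ count (λ p → P (p , false)) (allFin (2 * k)) + count (λ p → P (p , true)) (allFin (2 * k))
count-allPts k P = count-pairs (allFin (2 * k))
  where
  count-pairs : (ps : List (Fin (2 * k))) →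
                count P (Data.List.concatMap (λ p → (p , false) ∷ (p , true) ∷ []) ps)
                  ≡ count (λ p → P (p , false)) ps + count (λ p → P (p , true)) ps
  count-pairs [] = refl
  count-pairs (p ∷ ps) = trans (cong (λ c → bit (P (p , false)) + (bit (P (p , true)) + c)) (count-pairs ps))
    (solve 4 (λ a b x y → a :+ (b :+ (x :+ y)) := (a :+ x) :+ (b :+ y)) refl
      (bit (P (p , false))) (bit (P (p , true))) (count (λ p → P (p , false)) ps) (count (λ p → P (p , true)) ps))

allPts-enumerates : ∀ k → Enumeration.Enumerates (_≟ᵖ_ {k}) (allPts k)
allPts-enumerates k = record { once = once-allPts }
  where
  open Enumeration (Fin._≟_ {2 * k}) using (once)
  once-Fin : ∀ p → count (λ q → does (p Fin.≟ q)) (allFin (2 * k)) ≡ 1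
  once-Fin = once (allFin-enumerates (2 * k))
  once-allPts : ∀ x → count (λ y → does (_≟ᵖ_ {k} x y)) (allPts k) ≡ 1
  once-allPts (p , true) = trans (count-allPts k (λ y → does (_≟ᵖ_ {k} (p , true) y)))
    (cong₂ _+_ (count-none (λ _ → ∧-zeroʳ _) (allFin (2 * k)))
               (trans (count-cong (λ _ → ∧-identityʳ _) (allFin (2 * k))) (once-Fin p)))
  once-allPts (p , false) = trans (count-allPts k (λ y → does (_≟ᵖ_ {k} (p , false) y)))
    (trans (cong₂ _+_ (trans (count-cong (λ _ → ∧-identityʳ _) (allFin (2 * k))) (once-Fin p))
                      (count-none (λ _ → ∧-zeroʳ _) (allFin (2 * k))))
           refl)

code-injective : ∀ {k} {x y : Pt k} → code {k} x ≡ code {k} y → x ≡ y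
code-injective {k} {x = p , false} {y = q , false} eq =
  cong (_, false) (Fin.toℕ-injective (*-cancelˡ-≡ (toℕ p) (toℕ q) 2 eq))
code-injective {k} {x = p , true}  {y = q , true}  eq =
  cong (_, true) (Fin.toℕ-injective (*-cancelˡ-≡ (toℕ p) (toℕ q) 2 (+-cancelʳ-≡ 1 (2 * toℕ p) (2 * toℕ q) eq)))
code-injective {k} {x = p , false} {y = q , true}  eq =
  contradiction (trans eq (+-comm (2 * toℕ q) 1)) (even≢odd (toℕ p) (toℕ q))
code-injective {k} {x = p , true}  {y = q , false} eq =
  contradiction (trans (sym eq) (+-comm (2 * toℕ p) 1)) (even≢odd (toℕ q) (toℕ p))

faceCount : ℕ → ℕ → ℕ
faceCount n zero    = 1 + n % 2
faceCount n (suc k) = suc k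

module CompleteBouquet {m : ℕ} (B : Bouquet (suc m)) (complete : IntersectionGraphComplete B) where

  n : ℕ
  n = suc m

  N : ℕ
  N = 2 * n

  w : Fin N → Fin n
  w = word B

  module Loop     = Enumeration (Fin._≟_ {n})
  module Position = Enumeration (Fin._≟_ {N})

  on-loop : ∀ {p e} → w p ≡ e → (w p Loop.== e) ≡ true
  on-loop {p} {e} = dec-true (w p Fin.≟ e)

  two-ends : ∀ e → count (λ p → w p Loop.== e) (allFin N) ≡ 2
  two-ends e = trans (sym (length-filter≡count (λ p → w p Fin.≟ e) (allFin N))) (twice B e)

  other-end : ∀ p → ∃ λ q → q ≢ p × w q ≡ w p
  other-end p with Position.count≡2⇒other (allFin-enumerates N) (two-ends (w p)) (Loop.==-refl (w p))
  ... | q , q≢p , on = q , q≢p , Loop.==⇒≡ on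

  same-loop : ∀ {a b x} → a ≢ b → w a ≡ w b → w x ≡ w a → x ≡ a ⊎ x ≡ b
  same-loop {a} a≢b wa≡wb wx≡wa = Position.count≡2⇒either (allFin-enumerates N) (two-ends (w a))
    (Loop.==-refl (w a)) (on-loop (sym wa≡wb)) a≢b (on-loop wx≡wa)

  module Chord {a b : Fin N} (a<b : toℕ a < toℕ b) (wa≡wb : w a ≡ w b) where

    between : Fin N → Bool
    between p = (toℕ a <ᵇ toℕ p) ∧ (toℕ p <ᵇ toℕ b)

    a≢b : a ≢ b
    a≢b refl = <-irrefl refl a<b

    inside : ∀ {x} → toℕ a < toℕ x → toℕ x < toℕ b → between x ≡ true
    inside {x} a<x x<b = cong₂ _∧_ (dec-true (toℕ a <? toℕ x) a<x) (dec-true (toℕ x <? toℕ b) x<b)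

    before : ∀ {x} → toℕ x ≤ toℕ a → between x ≡ false
    before {x} x≤a = cong (_∧ (toℕ x <ᵇ toℕ b)) (dec-false (toℕ a <? toℕ x) (≤⇒≯ x≤a))

    after : ∀ {x} → toℕ b ≤ toℕ x → between x ≡ false
    after {x} b≤x = trans (cong ((toℕ a <ᵇ toℕ x) ∧_) (dec-false (toℕ x <? toℕ b) (≤⇒≯ b≤x))) (∧-zeroʳ _)

    ends-of-chord : ∀ {x y} → w x ≡ w a → w y ≡ w a → toℕ x < toℕ y → x ≡ a × y ≡ b
    ends-of-chord wx wy x<y with same-loop a≢b wa≡wb wx | same-loop a≢b wa≡wb wy
    ... | inj₁ refl | inj₁ refl = contradiction x<y (<-irrefl refl)
    ... | inj₁ refl | inj₂ refl = refl , refl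
    ... | inj₂ refl | inj₁ refl = contradiction x<y (<-asym a<b)
    ... | inj₂ refl | inj₂ refl = contradiction x<y (<-irrefl refl)

    crossing : ∀ f → w a ≢ f → ∃₂ λ x y → (w x ≡ f × between x ≡ true) × (w y ≡ f × between y ≡ false)
    crossing f wa≢f with complete (w a) f wa≢f
    ... | p₁ , q₁ , p₂ , q₂ , p₁<q₁ , q₁<p₂ , p₂<q₂ , inj₁ (wp₁ , wp₂ , wq₁ , wq₂)
        with ends-of-chord wp₁ wp₂ (<-trans p₁<q₁ q₁<p₂)
    ...   | refl , refl = q₁ , q₂ , (wq₁ , inside p₁<q₁ q₁<p₂) , (wq₂ , after (<⇒≤ p₂<q₂))
    crossing f wa≢f | p₁ , q₁ , p₂ , q₂ , p₁<q₁ , q₁<p₂ , p₂<q₂ , inj₂ (wp₁ , wp₂ , wq₁ , wq₂)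
        with ends-of-chord wq₁ wq₂ (<-trans q₁<p₂ p₂<q₂)
    ...   | refl , refl = p₂ , p₁ , (wp₂ , inside q₁<p₂ p₂<q₂) , (wp₁ , before (<⇒≤ p₁<q₁))

    between-on-loop : ∀ f → count (λ p → between p ∧ (w p Loop.== f)) (allFin N) ≡ bit (not (w a Loop.== f))
    between-on-loop f with w a Fin.≟ f
    ... | yes refl = count-none strictly-outside (allFin N)
      where
      strictly-outside : ∀ p → between p ∧ (w p Loop.== w a) ≡ false
      strictly-outside p with w p Fin.≟ w a
      ... | no _ = ∧-zeroʳ _
      ... | yes wp≡wa with same-loop a≢b wa≡wb wp≡wa
      ...   | inj₁ refl = trans (∧-identityʳ _) (before ≤-refl)
      ...   | inj₂ refl = trans (∧-identityʳ _) (after ≤-refl)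
    ... | no wa≢f with crossing f wa≢f
    ...   | x , y , (wx , x-in) , (wy , y-out) =
            trans (count-cong (λ p → ∧-comm (between p) _) (allFin N))
                  (Position.count≡2-split (allFin-enumerates N) (two-ends f)
                     (cong₂ _∧_ (on-loop wx) x-in) (cong₂ _∧_ (on-loop wy) (cong not y-out)))

    gap : toℕ b ∸ suc (toℕ a) ≡ m
    gap = begin
      toℕ b ∸ suc (toℕ a)
        ≡⟨ count-between N (toℕ a) (toℕ b) (<⇒≤ (Fin.toℕ<n b)) ⟨
      count between (allFin N)
        ≡⟨ Loop.count-fibres between w (allFin-enumerates n) (allFin N) ⟩
      sum (map (λ f → count (λ p → between p ∧ (w p Loop.== f)) (allFin N)) (allFin n))
        ≡⟨ sum-map-cong between-on-loop (allFin n) ⟩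
      count (λ f → not (w a Loop.== f)) (allFin n)
        ≡⟨ Loop.count-≢ (allFin-enumerates n) (w a) ⟩
      length (allFin n) ∸ 1
        ≡⟨ cong (_∸ 1) (length-tabulate {n = n} id) ⟩
      m ∎
      where open ≡-Reasoning

  chord-length : ∀ {a b} → toℕ a < toℕ b → w a ≡ w b → toℕ b ≡ toℕ a + n
  chord-length {a} {b} a<b wa≡wb = begin
    toℕ b                              ≡⟨ m∸n+n≡m a<b ⟨
    toℕ b ∸ suc (toℕ a) + suc (toℕ a)  ≡⟨ cong (_+ suc (toℕ a)) (Chord.gap a<b wa≡wb) ⟩
    m + suc (toℕ a)                    ≡⟨ +-comm m (suc (toℕ a)) ⟩
    suc (toℕ a + m)                    ≡⟨ +-suc (toℕ a) m ⟨
    toℕ a + n                          ∎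
    where open ≡-Reasoning

  -- Positions are handled through natural-number lifts read modulo N: moving along the vertex is
  -- addition, and congruences are stated without subtraction, as u + i * N ≡ v + j * N.
  pos : ℕ → Fin N
  pos v = v mod N

  toℕ-pos : ∀ v → toℕ (pos v) ≡ v % N
  toℕ-pos v = Fin.toℕ-fromℕ< (m%n<n v N)

  pos-toℕ : ∀ p → pos (toℕ p) ≡ p
  pos-toℕ p = Fin.toℕ-injective (trans (toℕ-pos (toℕ p)) (m<n⇒m%n≡m (Fin.toℕ<n p)))

  pos-cong : ∀ {u v} i j → u + i * N ≡ v + j * N → pos u ≡ pos v
  pos-cong {u} {v} i j eq = Fin.toℕ-injective (begin
    toℕ (pos u)      ≡⟨ toℕ-pos u ⟩
    u % N            ≡⟨ [m+kn]%n≡m%n u i N ⟨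
    (u + i * N) % N  ≡⟨ cong (_% N) eq ⟩
    (v + j * N) % N  ≡⟨ [m+kn]%n≡m%n v j N ⟩
    v % N            ≡⟨ toℕ-pos v ⟨
    toℕ (pos v)      ∎)
    where open ≡-Reasoning

  pos-+ : ∀ u a → pos (toℕ (pos u) + a) ≡ pos (u + a)
  pos-+ u a = pos-cong (u / N) 0 (begin
    toℕ (pos u) + a + u / N * N  ≡⟨ cong (λ r → r + a + u / N * N) (toℕ-pos u) ⟩
    u % N + a + u / N * N        ≡⟨ solve 3 (λ r a q → r :+ a :+ q := r :+ q :+ a :+ con 0) refl (u % N) a (u / N * N) ⟩
    u % N + u / N * N + a + 0    ≡⟨ cong (λ v → v + a + 0) (m≡m%n+[m/n]*n u N) ⟨
    u + a + 0                    ∎)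
    where open ≡-Reasoning

  pos-+n+n : ∀ v → pos (v + n + n) ≡ pos v
  pos-+n+n v = pos-cong 0 1 (solve 2 (λ v m → v :+ (con 1 :+ m) :+ (con 1 :+ m) :+ con 0
                                              := v :+ con 1 :* (con 2 :* (con 1 :+ m))) refl v m)

  other-end-pos : ∀ {p q} → q ≢ p → w q ≡ w p → q ≡ pos (toℕ p + n)
  other-end-pos {p} {q} q≢p wq≡wp with <-cmp (toℕ p) (toℕ q)
  ... | tri< p<q _ _ = trans (sym (pos-toℕ q)) (cong pos (chord-length p<q (sym wq≡wp)))
  ... | tri≈ _ p≡q _ = contradiction (Fin.toℕ-injective (sym p≡q)) q≢p
  ... | tri> _ _ q<p = sym (begin
    pos (toℕ p + n)      ≡⟨ cong (λ v → pos (v + n)) (chord-length q<p wq≡wp) ⟩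
    pos (toℕ q + n + n)  ≡⟨ pos-+n+n (toℕ q) ⟩
    pos (toℕ q)          ≡⟨ pos-toℕ q ⟩
    q                    ∎)
    where open ≡-Reasoning

  w-periodic : ∀ v → w (pos (v + n)) ≡ w (pos v)
  w-periodic v with other-end (pos v)
  ... | q , q≢pv , wq≡wpv = trans (cong w (trans (sym (pos-+ v n)) (sym (other-end-pos q≢pv wq≡wpv)))) wq≡wpv

  partner-pos : ∀ p → partner B p ≡ pos (toℕ p + n)
  partner-pos p with other-end p
  ... | q₀ , q₀≢p , wq₀≡wp
      with filter (λ q → ¬? (q Fin.≟ p) ×-dec (w q Fin.≟ w p)) (allFin N)
         | all-filter (λ q → ¬? (q Fin.≟ p) ×-dec (w q Fin.≟ w p)) (allFin N)
         | filter-some (λ q → ¬? (q Fin.≟ p) ×-dec (w q Fin.≟ w p)) (lose (∈-allFin q₀) (q₀≢p , wq₀≡wp))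
  ...   | []    | _                   | ()
  ...   | q ∷ _ | (q≢p , wq≡wp) ∷ _ | _ = other-end-pos q≢p wq≡wp

  partner-involutive : ∀ p → partner B (partner B p) ≡ p
  partner-involutive p rewrite partner-pos p | partner-pos (pos (toℕ p + n)) = begin
    pos (toℕ (pos (toℕ p + n)) + n)  ≡⟨ pos-+ (toℕ p + n) n ⟩
    pos (toℕ p + n + n)              ≡⟨ pos-+n+n (toℕ p) ⟩
    pos (toℕ p)                      ≡⟨ pos-toℕ p ⟩
    p                                ∎
    where open ≡-Reasoning

  w-partner : ∀ p → w (partner B p) ≡ w p
  w-partner p rewrite partner-pos p = trans (w-periodic (toℕ p)) (cong w (pos-toℕ p))

  nextF-pos : ∀ u → nextF (pos u) ≡ pos (suc u)
  nextF-pos u = trans (cong pos (+-comm 1 (toℕ (pos u)))) (trans (pos-+ u 1) (cong pos (+-comm u 1)))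

  -- The constant N − 1 added by prevF {N} normalises to m + 1 * n.
  prevF-pos : ∀ u → prevF (pos (suc u)) ≡ pos u
  prevF-pos u = trans (pos-+ (suc u) (m + 1 * n))
    (pos-cong 0 1 (solve 2 (λ u m → con 1 :+ u :+ (m :+ con 1 :* (con 1 :+ m)) :+ con 0
                                    := u :+ con 1 :* (con 2 :* (con 1 :+ m))) refl u m))

  cornerMatch-involutive : ∀ (x : Pt n) → cornerMatch {n} (cornerMatch {n} x) ≡ x
  cornerMatch-involutive (p , true)  = cong (_, true) (trans (prevF-pos (toℕ p)) (pos-toℕ p))
  cornerMatch-involutive (p , false) = cong (_, false) (begin
    nextF (prevF p)                       ≡⟨ nextF-pos (toℕ p + (m + 1 * n)) ⟩
    pos (suc (toℕ p + (m + 1 * n)))       ≡⟨ pos-cong 0 1 (solve 2 (λ v m → con 1 :+ (v :+ (m :+ con 1 :* (con 1 :+ m))) :+ con 0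
                                                   := v :+ con 1 :* (con 2 :* (con 1 :+ m))) refl (toℕ p) m) ⟩
    pos (toℕ p)                           ≡⟨ pos-toℕ p ⟩
    p                                     ∎)
    where open ≡-Reasoning

  nextF-across : ∀ v → nextF (pos (v + n)) ≡ pos (v + suc n)
  nextF-across v = trans (nextF-pos (v + n)) (cong pos (sym (+-suc v n)))

  prevF-across : ∀ v → prevF (pos (v + n)) ≡ pos (v + m)
  prevF-across v = trans (cong (prevF ∘ pos) (+-suc v m)) (prevF-pos (v + m))

  shift : Bool → ℕ
  shift false = suc n
  shift true  = m

  module Faces (t : Fin n → Bool) where

    φ : Pt n → Pt n
    φ x = cornerMatch {n} (ribbonMatch {n} B t x)

    ribbonMatch-involutive : ∀ x → ribbonMatch {n} B t (ribbonMatch {n} B t x) ≡ x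
    ribbonMatch-involutive (p , s) rewrite partner-involutive p | w-partner p with t (w p)
    ... | true  = refl
    ... | false = cong (p ,_) (not-involutive s)

    φ-injective : ∀ {x y} → φ x ≡ φ y → x ≡ y
    φ-injective {x} {y} φx≡φy = trans (sym (undo x)) (trans (cong ψ φx≡φy) (undo y))
      where
      ψ : Pt n → Pt n
      ψ z = ribbonMatch {n} B t (cornerMatch {n} z)
      undo : ∀ z → ψ (φ z) ≡ z
      undo z = trans (cong (ribbonMatch {n} B t) (cornerMatch-involutive _)) (ribbonMatch-involutive z)

    faces-by-transversal : (R : Pt n → Bool) → (∀ x → Reaches φ R x) →
                           (∀ r → R r ≡ true → FirstReturn φ R (4 * n) r) →
                           faces B t ≡ count R (allPts n) / 2
    faces-by-transversal R reaches returns = cong (_/ 2) (begin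
      length (filter (λ x → isOrbitMin x Bool.≟ true) (allPts n))
        ≡⟨ length-filter≡count (λ x → isOrbitMin x Bool.≟ true) (allPts n) ⟩
      count (λ x → does (isOrbitMin x Bool.≟ true)) (allPts n)
        ≡⟨ count-cong (λ x → does-≟-true (isOrbitMin x)) (allPts n) ⟩
      count isOrbitMin (allPts n)
        ≡⟨ count-isOrbitMin ⟩
      count R (allPts n) ∎)
      where
      open ≡-Reasoning
      open OrbitCount (_≟ᵖ_ {n}) (allPts-enumerates n) φ φ-injective (code {n}) code-injective (4 * n) R reaches returns
      does-≟-true : ∀ b → does (b Bool.≟ true) ≡ b
      does-≟-true false = refl
      does-≟-true true  = refl

    twistAt : ℕ → Bool
    twistAt v = t (w (pos v))

    twistAt-+* : ∀ v k → twistAt (v + k * n) ≡ twistAt v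
    twistAt-+* v zero    = cong twistAt (+-identityʳ v)
    twistAt-+* v (suc k) = trans (cong twistAt (sym (+-assoc v n (k * n))))
                                 (trans (twistAt-+* (v + n) k) (cong t (w-periodic v)))

    twistAt-cong : ∀ {u v} i j → u + i * n ≡ v + j * n → twistAt u ≡ twistAt v
    twistAt-cong {u} {v} i j eq = trans (sym (twistAt-+* u i)) (trans (cong twistAt eq) (twistAt-+* v j))

    -- Crossing the ribbon at v leads to the opposite position v + n; the next corner step moves one
    -- position forward on the false side and one back (v + n − 1 = v + m) on the true side.
    φ-pos : ∀ v s → φ (pos v , s) ≡ (if s xor twistAt v then (pos (v + m) , true) else (pos (v + suc n) , false))
    φ-pos v s rewrite partner-pos (pos v) | pos-+ v n with twistAt v | s
    ... | true  | true  = cong (_, false) (nextF-across v)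
    ... | true  | false = cong (_, true) (prevF-across v)
    ... | false | true  = cong (_, true) (prevF-across v)
    ... | false | false = cong (_, false) (nextF-across v)

    run-false : ∀ v a → (∀ c → c < a → twistAt (v + c) ≡ false) →
                iter a φ (pos v , false) ≡ (pos (v + a * suc n) , false)
    run-false v zero    _     = cong (λ u → pos u , false) (sym (+-identityʳ v))
    run-false v (suc a) plain = begin
      φ (iter a φ (pos v , false))
        ≡⟨ cong φ (run-false v a (λ c c<a → plain c (m<n⇒m<1+n c<a))) ⟩
      φ (pos (v + a * suc n) , false)
        ≡⟨ φ-pos (v + a * suc n) false ⟩
      (if twistAt (v + a * suc n) then (pos (v + a * suc n + m) , true) else (pos (v + a * suc n + suc n) , false))
        ≡⟨ cong (if_then (pos (v + a * suc n + m) , true) else (pos (v + a * suc n + suc n) , false)) plain-here ⟩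
      (pos (v + a * suc n + suc n) , false)
        ≡⟨ cong (λ u → pos u , false) (solve 3 (λ v a m → v :+ a :* (con 2 :+ m) :+ (con 2 :+ m)
                                                   := v :+ (con 1 :+ a) :* (con 2 :+ m)) refl v a m) ⟩
      (pos (v + suc a * suc n) , false) ∎
      where
      open ≡-Reasoning
      plain-here : twistAt (v + a * suc n) ≡ false
      plain-here = trans (twistAt-cong 0 a (solve 3 (λ v a m → v :+ a :* (con 2 :+ m) :+ con 0 :* (con 1 :+ m)
                                                   := v :+ a :+ a :* (con 1 :+ m)) refl v a m))
                         (plain a (n<1+n a))

    run-true : ∀ v a → (∀ c → c < a → twistAt (v + c * m) ≡ false) →
               iter a φ (pos v , true) ≡ (pos (v + a * m) , true)
    run-true v zero    _     = cong (λ u → pos u , true) (sym (+-identityʳ v))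
    run-true v (suc a) plain = begin
      φ (iter a φ (pos v , true))
        ≡⟨ cong φ (run-true v a (λ c c<a → plain c (m<n⇒m<1+n c<a))) ⟩
      φ (pos (v + a * m) , true)
        ≡⟨ φ-pos (v + a * m) true ⟩
      (if not (twistAt (v + a * m)) then (pos (v + a * m + m) , true) else (pos (v + a * m + suc n) , false))
        ≡⟨ cong (λ b → if not b then (pos (v + a * m + m) , true) else (pos (v + a * m + suc n) , false)) (plain a (n<1+n a)) ⟩
      (pos (v + a * m + m) , true)
        ≡⟨ cong (λ u → pos u , true) (solve 3 (λ v a m → v :+ a :* m :+ m := v :+ (con 1 :+ a) :* m) refl v a m) ⟩
      (pos (v + suc a * m) , true) ∎
      where open ≡-Reasoning

    φ-at-twist : ∀ u s → twistAt u ≡ true →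
                 φ (pos u , s) ≡ (if s then (pos (u + suc n) , false) else (pos (u + m) , true))
    φ-at-twist u true  tw = trans (φ-pos u true)  (cong (λ b → if not b then _ else _) tw)
    φ-at-twist u false tw = trans (φ-pos u false) (cong (λ b → if b then _ else _) tw)

    twistedEnd : Pt n → Bool
    twistedEnd (p , s) = s ∧ t (w p)

    -- Modulo n the true side steps through the loops backwards (m ≡ −1) and the false side forwards
    -- (n + 1 ≡ 1); the offsets c = v + v₀ * m and c = v₀ + v * m reach the twisted loop at v₀.
    module TwistedReach (v₀ : ℕ) (twisted-v₀ : twistAt v₀ ≡ true) where

      twisted-backward : ∀ v → twistAt (v + (v + v₀ * m) * m) ≡ true
      twisted-backward v = trans (twistAt-cong (2 * v₀) (v + v₀ * n)
        (solve 3 (λ v v₀ m → v :+ (v :+ v₀ :* m) :* m :+ (con 2 :* v₀) :* (con 1 :+ m)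
                             := v₀ :+ (v :+ v₀ :* (con 1 :+ m)) :* (con 1 :+ m)) refl v v₀ m)) twisted-v₀

      twisted-forward : ∀ v → twistAt (v + (v₀ + v * m)) ≡ true
      twisted-forward v = trans (twistAt-cong 0 v
        (solve 3 (λ v v₀ m → v :+ (v₀ :+ v :* m) :+ con 0 :* (con 1 :+ m) := v₀ :+ v :* (con 1 :+ m)) refl v v₀ m)) twisted-v₀

      reach-from-true : ∀ v → Reaches φ twistedEnd (pos v , true)
      reach-from-true v with ∃-least (λ c → twistAt (v + c * m)) {v + v₀ * m} (twisted-backward v)
      ... | c , _ , twisted-c , plain-before = c , subst (λ x → twistedEnd x ≡ true) (sym (run-true v c plain-before)) twisted-c

      reach-from-false : ∀ v → Reaches φ twistedEnd (pos v , false)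
      reach-from-false v with ∃-least (λ c → twistAt (v + c)) {v₀ + v * m} (twisted-forward v)
      ... | c , _ , twisted-c , plain-before with reach-from-true (v + c * suc n + m)
      ...   | a , hits = a + suc c , subst (λ x → twistedEnd x ≡ true) (sym crossed) hits
        where
        u : ℕ
        u = v + c * suc n
        twisted-u : twistAt u ≡ true
        twisted-u = trans (twistAt-cong 0 c (solve 3 (λ v c m → v :+ c :* (con 2 :+ m) :+ con 0 :* (con 1 :+ m)
                                                       := v :+ c :+ c :* (con 1 :+ m)) refl v c m)) twisted-c
        crossed : iter (a + suc c) φ (pos v , false) ≡ iter a φ (pos (u + m) , true)
        crossed = trans (iter-+ φ a (suc c) (pos v , false))
                        (cong (iter a φ) (trans (cong φ (run-false v c plain-before)) (φ-at-twist u false twisted-u)))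

      reaches : ∀ x → Reaches φ twistedEnd x
      reaches (p , true)  = subst (λ q → Reaches φ twistedEnd (q , true))  (pos-toℕ p) (reach-from-true (toℕ p))
      reaches (p , false) = subst (λ q → Reaches φ twistedEnd (q , false)) (pos-toℕ p) (reach-from-false (toℕ p))

    -- From a twisted end (v , true) the orbit crosses to the false side, walks forward past the a
    -- untwisted loops following v to the next twisted loop, crosses back, and walks backward past
    -- the same a loops to v; only its starting point is a twisted end on the true side.
    module TwistedReturn (v : ℕ) (twisted-v : twistAt v ≡ true)
                         (a : ℕ) (a≤m : a ≤ m) (twisted-a : twistAt (v + 1 + a) ≡ true)
                         (plain-before-a : ∀ c → c < a → twistAt (v + 1 + c) ≡ false) where

      r : Pt n
      r = pos v , true

      u : ℕ
      u = v + suc n + a * suc n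

      outward : ∀ j → j ≤ a → iter (suc j) φ r ≡ (pos (v + suc n + j * suc n) , false)
      outward j j≤a = begin
        iter (suc j) φ r          ≡⟨ cong (λ k → iter k φ r) (+-comm 1 j) ⟩
        iter (j + 1) φ r          ≡⟨ iter-+ φ j 1 r ⟩
        iter j φ (φ r)            ≡⟨ cong (iter j φ) (φ-at-twist v true twisted-v) ⟩
        iter j φ (pos (v + suc n) , false)
                                  ≡⟨ run-false (v + suc n) j plain ⟩
        (pos (v + suc n + j * suc n) , false) ∎
        where
        open ≡-Reasoning
        plain : ∀ c → c < j → twistAt (v + suc n + c) ≡ false
        plain c c<j = trans (twistAt-cong 0 1 (solve 3 (λ v c m → v :+ (con 2 :+ m) :+ c :+ con 0 :* (con 1 :+ m)
                                                         := v :+ con 1 :+ c :+ con 1 :* (con 1 :+ m)) refl v c m))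
                            (plain-before-a c (<-≤-trans c<j j≤a))

      twisted-u : twistAt u ≡ true
      twisted-u = trans (twistAt-cong 0 (suc a) (solve 3 (λ v a m → v :+ (con 2 :+ m) :+ a :* (con 2 :+ m) :+ con 0 :* (con 1 :+ m)
                                                         := v :+ con 1 :+ a :+ (con 1 :+ a) :* (con 1 :+ m)) refl v a m))
                        twisted-a

      plain-inward : ∀ c → c < a → twistAt (u + m + c * m) ≡ false
      plain-inward c c<a = trans (twistAt-cong 0 (a + c + 2) (arith a (m+[n∸m]≡n c<a)))
                                 (plain-before-a (a ∸ suc c) (∸-monoʳ-< z<s c<a))
        where
        arith : ∀ a′ → suc c + (a ∸ suc c) ≡ a′ →
                v + suc n + a′ * suc n + m + c * m + 0 * n ≡ v + 1 + (a ∸ suc c) + (a′ + c + 2) * n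
        arith .(suc c + (a ∸ suc c)) refl =
          solve 4 (λ v c e m → v :+ (con 2 :+ m) :+ (con 1 :+ c :+ e) :* (con 2 :+ m) :+ m :+ c :* m :+ con 0 :* (con 1 :+ m)
                               := v :+ con 1 :+ e :+ (con 1 :+ c :+ e :+ c :+ con 2) :* (con 1 :+ m)) refl v c (a ∸ suc c) m

      inward : ∀ c → c ≤ a → iter (c + (2 + a)) φ r ≡ (pos (u + m + c * m) , true)
      inward c c≤a = begin
        iter (c + (2 + a)) φ r              ≡⟨ iter-+ φ c (2 + a) r ⟩
        iter c φ (φ (iter (suc a) φ r))     ≡⟨ cong (iter c φ ∘ φ) (outward a ≤-refl) ⟩
        iter c φ (φ (pos u , false))        ≡⟨ cong (iter c φ) (φ-at-twist u false twisted-u) ⟩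
        iter c φ (pos (u + m) , true)       ≡⟨ run-true (u + m) c (λ c′ c′<c → plain-inward c′ (<-≤-trans c′<c c≤a)) ⟩
        (pos (u + m + c * m) , true)        ∎
        where open ≡-Reasoning

      period : ℕ
      period = a + (2 + a)

      avoids : ∀ i → 0 < i → i < period → twistedEnd (iter i φ r) ≡ false
      avoids (suc j) _ i<P with j ≤? a
      ... | yes j≤a = cong twistedEnd (outward j j≤a)
      ... | no  j≰a with m≤n⇒∃[o]m+o≡n (≰⇒> j≰a)
      ...   | c , refl = begin
        twistedEnd (iter (suc (suc a + c)) φ r)   ≡⟨ cong (λ k → twistedEnd (iter k φ r)) (reorder a c) ⟩
        twistedEnd (iter (c + (2 + a)) φ r)       ≡⟨ cong twistedEnd (inward c (<⇒≤ c<a)) ⟩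
        twistAt (u + m + c * m)                   ≡⟨ plain-inward c c<a ⟩
        false                                     ∎
        where
        open ≡-Reasoning
        reorder : ∀ a c → suc (suc a + c) ≡ c + (2 + a)
        reorder = solve 2 (λ a c → con 2 :+ a :+ c := c :+ (con 2 :+ a)) refl
        c<a : c < a
        c<a = +-cancelʳ-< (2 + a) c a (subst (_< period) (reorder a c) i<P)

      firstReturn : FirstReturn φ twistedEnd (4 * n) r
      firstReturn = record
        { period    = period
        ; period>0  = <-≤-trans z<s (m≤n+m (2 + a) a)
        ; 2period≤L = subst (_≤ 4 * n) (solve 1 (λ a → con 4 :* (con 1 :+ a) := con 2 :* (a :+ (con 2 :+ a))) refl a)
                            (*-monoʳ-≤ 4 (s≤s a≤m))
        ; periodic  = trans (inward a ≤-refl) (cong (_, true) (pos-cong 0 (suc a)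
                        (solve 3 (λ v a m → v :+ (con 2 :+ m) :+ a :* (con 2 :+ m) :+ m :+ a :* m :+ con 0
                                            := v :+ (con 1 :+ a) :* (con 2 :* (con 1 :+ m))) refl v a m)))
        ; avoids    = avoids
        }

    returns-twisted : ∀ r → twistedEnd r ≡ true → FirstReturn φ twistedEnd (4 * n) r
    returns-twisted (p , true) tw with ∃-least (λ c → twistAt (toℕ p + 1 + c)) {m} twisted-after-loop
      where
      twisted-after-loop : twistAt (toℕ p + 1 + m) ≡ true
      twisted-after-loop = trans (twistAt-cong 0 1 (solve 2 (λ v m → v :+ con 1 :+ m :+ con 0 :* (con 1 :+ m)
                                                                 := v :+ con 1 :* (con 1 :+ m)) refl (toℕ p) m))
                                 (trans (cong (t ∘ w) (pos-toℕ p)) tw)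
    ... | a , a≤m , twisted-a , plain-before-a = subst (FirstReturn φ twistedEnd (4 * n)) (cong (_, true) (pos-toℕ p))
      (TwistedReturn.firstReturn (toℕ p) (trans (cong (t ∘ w) (pos-toℕ p)) tw) a a≤m twisted-a plain-before-a)

    count-twistedEnd : count twistedEnd (allPts n) ≡ count t (allFin n) * 2
    count-twistedEnd = trans (count-allPts n twistedEnd)
      (cong₂ _+_ (count-none (λ _ → refl) (allFin N)) (Loop.count-∘ t w (allFin-enumerates n) (allFin N) two-ends))

    twisted-faces : ∀ p → t (w p) ≡ true → faces B t ≡ count t (allFin n)
    twisted-faces p tw = begin
      faces B t                        ≡⟨ faces-by-transversal twistedEnd (TwistedReach.reaches (toℕ p) twisted-p) returns-twisted ⟩
      count twistedEnd (allPts n) / 2  ≡⟨ cong (_/ 2) count-twistedEnd ⟩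
      count t (allFin n) * 2 / 2       ≡⟨ m*n/n≡m (count t (allFin n)) 2 ⟩
      count t (allFin n)               ∎
      where
      open ≡-Reasoning
      twisted-p : twistAt (toℕ p) ≡ true
      twisted-p = trans (cong (t ∘ w) (pos-toℕ p)) tw

    -- Without twists φ translates each side by shift s, a unit modulo d, so the orbits are the residue
    -- classes modulo d and the multiples of d form a transversal. Here d = n for odd n, 2n for even n.
    module Untwisted (untwisted : ∀ e → t e ≡ false) (d′ q : ℕ) (q*d≡N : q * suc d′ ≡ N)
                     (shift-unit : ∀ s → ∃₂ λ i j → shift s * shift s + i * suc d′ ≡ 1 + j * suc d′)
                     (N∣d*shift : ∀ s → N ∣ suc d′ * shift s) where

      d : ℕ
      d = suc d′

      iter-untwisted : ∀ i v s → iter i φ (pos v , s) ≡ (pos (v + i * shift s) , s)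
      iter-untwisted i v false = run-false v i (λ _ _ → untwisted _)
      iter-untwisted i v true  = run-true  v i (λ _ _ → untwisted _)

      atMultiple : Pt n → Bool
      atMultiple (p , _) = does (d ∣? toℕ p)

      d∣N : d ∣ N
      d∣N = divides q (sym q*d≡N)

      atMultiple-pos : ∀ u s → atMultiple (pos u , s) ≡ does (d ∣? u)
      atMultiple-pos u s = does-⇔
        (mk⇔ (λ d∣pu → ∣n∣m%n⇒∣m d∣N (subst (d ∣_) (toℕ-pos u) d∣pu))
             (λ d∣u → subst (d ∣_) (sym (toℕ-pos u)) (%-presˡ-∣ d∣u d∣N)))
        (d ∣? toℕ (pos u)) (d ∣? u)

      shift-coprime : ∀ s i → d ∣ i * shift s → d ∣ i
      shift-coprime s i d∣ia with shift-unit s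
      ... | k , l , aa+kd≡1+ld =
        ∣m+n∣m⇒∣n (subst (d ∣_) expand (∣m∣n⇒∣m+n (∣m⇒∣m*n a d∣ia) (n∣m*n (i * k)))) (n∣m*n (i * l))
        where
        open ≡-Reasoning
        a : ℕ
        a = shift s
        expand : i * a * a + i * k * d ≡ i * l * d + i
        expand = begin
          i * a * a + i * k * d  ≡⟨ solve 4 (λ i a k d → i :* a :* a :+ i :* k :* d := i :* (a :* a :+ k :* d)) refl i a k d ⟩
          i * (a * a + k * d)    ≡⟨ cong (i *_) aa+kd≡1+ld ⟩
          i * (1 + l * d)        ≡⟨ solve 3 (λ i l d → i :* (con 1 :+ l :* d) := i :* l :* d :+ i) refl i l d ⟩
          i * l * d + i          ∎

      -- c = (d − 1) v a works because a * a ≡ 1 modulo d.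
      hits-multiple : ∀ s v → ∃ λ c → d ∣ v + c * shift s
      hits-multiple s v with shift-unit s
      ... | k , l , aa+kd≡1+ld =
        d′ * v * a , ∣m+n∣m⇒∣n (subst (d ∣_) (sym expand) (n∣m*n (v + d′ * v * l))) (n∣m*n (d′ * v * k))
        where
        open ≡-Reasoning
        a : ℕ
        a = shift s
        expand : d′ * v * k * d + (v + d′ * v * a * a) ≡ (v + d′ * v * l) * d
        expand = begin
          d′ * v * k * d + (v + d′ * v * a * a)
            ≡⟨ solve 5 (λ d′ v k a d → d′ :* v :* k :* d :+ (v :+ d′ :* v :* a :* a) := v :+ d′ :* v :* (a :* a :+ k :* d))
                       refl d′ v k a d ⟩
          v + d′ * v * (a * a + k * d)
            ≡⟨ cong (λ z → v + d′ * v * z) aa+kd≡1+ld ⟩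
          v + d′ * v * (1 + l * d)
            ≡⟨ solve 3 (λ d′ v l → v :+ d′ :* v :* (con 1 :+ l :* (con 1 :+ d′)) := (v :+ d′ :* v :* l) :* (con 1 :+ d′))
                       refl d′ v l ⟩
          (v + d′ * v * l) * d ∎

      misses-multiple : ∀ s {v i} → d ∣ v → 0 < i → i < d → ¬ d ∣ v + i * shift s
      misses-multiple s {v} {suc i} d∣v _ i<d d∣v+ia =
        >⇒∤ i<d (shift-coprime s (suc i) (∣m+n∣m⇒∣n d∣v+ia d∣v))

      reaches-multiple : ∀ x → Reaches φ atMultiple x
      reaches-multiple (p , s) = c , (begin
        atMultiple (iter c φ (p , s))               ≡⟨ cong (λ q → atMultiple (iter c φ (q , s))) (pos-toℕ p) ⟨
        atMultiple (iter c φ (pos (toℕ p) , s))     ≡⟨ cong atMultiple (iter-untwisted c (toℕ p) s) ⟩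
        atMultiple (pos (toℕ p + c * shift s) , s)  ≡⟨ atMultiple-pos (toℕ p + c * shift s) s ⟩
        does (d ∣? toℕ p + c * shift s)             ≡⟨ dec-true (d ∣? toℕ p + c * shift s) (proj₂ (hits-multiple s (toℕ p))) ⟩
        true                                        ∎)
        where
        open ≡-Reasoning
        c : ℕ
        c = proj₁ (hits-multiple s (toℕ p))

      returns-multiple : ∀ r → atMultiple r ≡ true → FirstReturn φ atMultiple (4 * n) r
      returns-multiple (p , s) at-p = subst (FirstReturn φ atMultiple (4 * n)) (cong (_, s) (pos-toℕ p)) (record
        { period    = d
        ; period>0  = z<s
        ; 2period≤L = subst (2 * d ≤_) (solve 1 (λ m → con 2 :* (con 2 :* (con 1 :+ m)) := con 4 :* (con 1 :+ m)) refl m)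
                            (*-monoʳ-≤ 2 (∣⇒≤ d∣N))
        ; periodic  = trans (iter-untwisted d v s) (cong (_, s) (periodic-shift (N∣d*shift s)))
        ; avoids    = avoids
        })
        where
        v : ℕ
        v = toℕ p
        d∣v : d ∣ v
        d∣v = witness (d ∣? v) at-p
        periodic-shift : N ∣ d * shift s → pos (v + d * shift s) ≡ pos v
        periodic-shift (divides k d*a≡kN) = pos-cong 0 k (trans (+-identityʳ _) (cong (v +_) d*a≡kN))
        avoids : ∀ i → 0 < i → i < d → atMultiple (iter i φ (pos v , s)) ≡ false
        avoids i 0<i i<d = trans (cong atMultiple (iter-untwisted i v s))
          (trans (atMultiple-pos (v + i * shift s) s) (dec-false (d ∣? v + i * shift s) (misses-multiple s d∣v 0<i i<d)))

      count-atMultiple : count atMultiple (allPts n) ≡ q * 2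
      count-atMultiple = trans (count-allPts n atMultiple)
        (trans (cong₂ _+_ multiples multiples) (solve 1 (λ q → q :+ q := q :* con 2) refl q))
        where
        multiples : count (λ p → does (d ∣? toℕ p)) (allFin N) ≡ q
        multiples = subst (λ K → count (λ p → does (d ∣? toℕ p)) (allFin K) ≡ q) q*d≡N (count-multiples q d)

      faces-≡ : faces B t ≡ q
      faces-≡ = begin
        faces B t                        ≡⟨ faces-by-transversal atMultiple reaches-multiple returns-multiple ⟩
        count atMultiple (allPts n) / 2  ≡⟨ cong (_/ 2) count-atMultiple ⟩
        q * 2 / 2                        ≡⟨ m*n/n≡m q 2 ⟩
        q                                ∎
        where open ≡-Reasoning

    untwisted-faces : (∀ e → t e ≡ false) → faces B t ≡ 1 + n % 2
    untwisted-faces untwisted with n % 2 | m%n<n n 2 | m≡m%n+[m/n]*n n 2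
    ... | 0 | _ | n≡h*2 = Untwisted.faces-≡ untwisted (m + 1 * n) 1 (+-identityʳ N) shift-unit (λ s → m∣m*n (shift s))
      where
      open ≡-Reasoning
      h : ℕ
      h = n / 2
      n*n≡h*N : n * n ≡ h * N
      n*n≡h*N = trans (cong (n *_) n≡h*2) (solve 2 (λ n h → n :* (h :* con 2) := h :* (con 2 :* n)) refl n h)
      shift-unit : ∀ s → ∃₂ λ i j → shift s * shift s + i * N ≡ 1 + j * N
      shift-unit false = 0 , suc h , (begin
        suc n * suc n + 0 * N  ≡⟨ solve 1 (λ n → (con 1 :+ n) :* (con 1 :+ n) :+ con 0 := con 1 :+ (con 2 :* n :+ n :* n)) refl n ⟩
        1 + (N + n * n)        ≡⟨ cong (λ z → 1 + (N + z)) n*n≡h*N ⟩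
        1 + suc h * N          ∎)
      shift-unit true = 1 , h , (begin
        m * m + 1 * N  ≡⟨ solve 1 (λ m → m :* m :+ con 1 :* (con 2 :* (con 1 :+ m)) := con 1 :+ (con 1 :+ m) :* (con 1 :+ m)) refl m ⟩
        1 + n * n      ≡⟨ cong (1 +_) n*n≡h*N ⟩
        1 + h * N      ∎)
    ... | 1 | _ | n≡1+h*2 = Untwisted.faces-≡ untwisted m 2 refl shift-unit N∣n*shift
      where
      h : ℕ
      h = n / 2
      m≡h*2 : m ≡ h * 2
      m≡h*2 = suc-injective n≡1+h*2
      shift-unit : ∀ s → ∃₂ λ i j → shift s * shift s + i * n ≡ 1 + j * n
      shift-unit false = 0 , suc (suc n) ,
        solve 1 (λ m → (con 2 :+ m) :* (con 2 :+ m) :+ con 0 := con 1 :+ (con 3 :+ m) :* (con 1 :+ m)) refl m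
      shift-unit true = 2 , n ,
        solve 1 (λ m → m :* m :+ con 2 :* (con 1 :+ m) := con 1 :+ (con 1 :+ m) :* (con 1 :+ m)) refl m
      N∣n*shift : ∀ s → N ∣ n * shift s
      N∣n*shift false = divides (suc h) (trans (cong (λ z → n * suc (suc z)) m≡h*2)
        (solve 2 (λ n h → n :* (con 2 :+ h :* con 2) := (con 1 :+ h) :* (con 2 :* n)) refl n h))
      N∣n*shift true = divides h (trans (cong (n *_) m≡h*2)
        (solve 2 (λ n h → n :* (h :* con 2) := h :* (con 2 :* n)) refl n h))
    ... | suc (suc _) | s≤s (s≤s ()) | _

    faces-complete : faces B t ≡ faceCount n (count t (allFin n))
    faces-complete with count t (allFin n) in t-count
    ... | zero  = untwisted-faces (Loop.count≡0⇒false (allFin-enumerates n) t-count)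
    ... | suc k with count-witness t (allFin n) (subst (0 <_) (sym t-count) z<s)
    ...   | e , te with count-witness (λ p → w p Loop.== e) (allFin N) (subst (0 <_) (sym (two-ends e)) z<s)
    ...     | p , wp≡e = trans (twisted-faces p (trans (cong t (Loop.==⇒≡ wp≡e)) te)) t-count

-- Summing over the partial Petrials

sum-applyUpTo-cong : ∀ {g h : ℕ → ℕ} → g ≗ h → ∀ K → sum (applyUpTo g K) ≡ sum (applyUpTo h K)
sum-applyUpTo-cong g≗h zero    = refl
sum-applyUpTo-cong g≗h (suc K) = cong₂ _+_ (g≗h 0) (sum-applyUpTo-cong (g≗h ∘ suc) K)

sum-applyUpTo-+ : ∀ (g h : ℕ → ℕ) K → sum (applyUpTo (λ c → g c + h c) K) ≡ sum (applyUpTo g K) + sum (applyUpTo h K)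
sum-applyUpTo-+ g h zero    = refl
sum-applyUpTo-+ g h (suc K) =
  trans (cong (g 0 + h 0 +_) (sum-applyUpTo-+ (g ∘ suc) (h ∘ suc) K)) (interchange (g 0) (h 0) _ _)

sum-applyUpTo-suc : ∀ (g : ℕ → ℕ) K → sum (applyUpTo g (suc K)) ≡ sum (applyUpTo g K) + g K
sum-applyUpTo-suc g zero    = +-identityʳ (g 0)
sum-applyUpTo-suc g (suc K) = trans (cong (g 0 +_) (sum-applyUpTo-suc (g ∘ suc) K)) (sym (+-assoc (g 0) _ _))

sum-pascal : ∀ n (f : ℕ → ℕ) →
             sum (applyUpTo (λ c → f c * (suc n C c)) (suc (suc n)))
               ≡ sum (applyUpTo (λ c → f c * (n C c)) (suc n)) + sum (applyUpTo (λ c → f (suc c) * (n C c)) (suc n))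
sum-pascal n f = begin
  f 0 * 1 + sum (applyUpTo (λ c → f (suc c) * (suc n C suc c)) (suc n))
    ≡⟨ cong (f 0 * 1 +_) (sum-applyUpTo-cong pascal (suc n)) ⟩
  f 0 * 1 + sum (applyUpTo (λ c → f (suc c) * (n C c) + f (suc c) * (n C suc c)) (suc n))
    ≡⟨ cong (f 0 * 1 +_) (sum-applyUpTo-+ (λ c → f (suc c) * (n C c)) (λ c → f (suc c) * (n C suc c)) (suc n)) ⟩
  f 0 * 1 + (Y + sum (applyUpTo (λ c → f (suc c) * (n C suc c)) (suc n)))
    ≡⟨ cong (λ z → f 0 * 1 + (Y + z)) (sum-applyUpTo-suc (λ c → f (suc c) * (n C suc c)) n) ⟩
  f 0 * 1 + (Y + (Z + f (suc n) * (n C suc n)))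
    ≡⟨ cong (λ z → f 0 * 1 + (Y + (Z + f (suc n) * z))) (k>n⇒nCk≡0 (n<1+n n)) ⟩
  f 0 * 1 + (Y + (Z + f (suc n) * 0))
    ≡⟨ solve 4 (λ a y z b → a :+ (y :+ (z :+ b :* con 0)) := a :+ z :+ y) refl (f 0 * 1) Y Z (f (suc n)) ⟩
  f 0 * 1 + Z + Y ∎
  where
  open ≡-Reasoning
  Y Z : ℕ
  Y = sum (applyUpTo (λ c → f (suc c) * (n C c)) (suc n))
  Z = sum (applyUpTo (λ c → f (suc c) * (n C suc c)) n)
  pascal : ∀ c → f (suc c) * (suc n C suc c) ≡ f (suc c) * (n C c) + f (suc c) * (n C suc c)
  pascal c = trans (cong (f (suc c) *_) (sym (nCk+nC[k+1]≡[n+1]C[k+1] n c))) (*-distribˡ-+ (f (suc c)) _ _)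

sum-subsets : ∀ n (u : Fin n → Bool) (f : ℕ → ℕ) →
              sum (map (λ A → f (count (λ e → u e xor lookup A e) (allFin n))) (allSubsets n))
                ≡ sum (applyUpTo (λ c → f c * (n C c)) (suc n))
sum-subsets zero    u f = cong (_+ 0) (sym (*-identityʳ (f 0)))
sum-subsets (suc n) u f = begin
  sum (map F (map (true ∷ᵥ_) S ++ map (false ∷ᵥ_) S))
    ≡⟨ trans (cong sum (map-++ F (map (true ∷ᵥ_) S) _)) (sum-++ (map F (map (true ∷ᵥ_) S)) _) ⟩
  sum (map F (map (true ∷ᵥ_) S)) + sum (map F (map (false ∷ᵥ_) S))
    ≡⟨ cong₂ _+_ (trans (cong sum (sym (map-∘ S))) (sum-map-cong (F-∷ true) S))
                 (trans (cong sum (sym (map-∘ S))) (sum-map-cong (F-∷ false) S)) ⟩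
  sum (map (λ A → f (bit (u zero xor true) + rest A)) S) + sum (map (λ A → f (bit (u zero xor false) + rest A)) S)
    ≡⟨ by-first-twist (u zero) ⟩
  sum (applyUpTo (λ c → f c * (n C c)) (suc n)) + sum (applyUpTo (λ c → f (suc c) * (n C c)) (suc n))
    ≡⟨ sum-pascal n f ⟨
  sum (applyUpTo (λ c → f c * (suc n C c)) (suc (suc n))) ∎
  where
  open ≡-Reasoning
  S : List (Vec Bool n)
  S = allSubsets n
  F : Vec Bool (suc n) → ℕ
  F A = f (count (λ e → u e xor lookup A e) (allFin (suc n)))
  rest : Vec Bool n → ℕ
  rest A = count (λ e → u (suc e) xor lookup A e) (allFin n)
  F-∷ : ∀ b A → F (b ∷ᵥ A) ≡ f (bit (u zero xor b) + rest A)
  F-∷ b A = cong f (count-allFin-suc n (λ e → u e xor lookup (b ∷ᵥ A) e))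
  by-first-twist : ∀ b → sum (map (λ A → f (bit (b xor true) + rest A)) S) + sum (map (λ A → f (bit (b xor false) + rest A)) S)
                           ≡ sum (applyUpTo (λ c → f c * (n C c)) (suc n)) + sum (applyUpTo (λ c → f (suc c) * (n C c)) (suc n))
  by-first-twist true  = cong₂ _+_ (sum-subsets n (u ∘ suc) f) (sum-subsets n (u ∘ suc) (f ∘ suc))
  by-first-twist false = trans (cong₂ _+_ (sum-subsets n (u ∘ suc) (f ∘ suc)) (sum-subsets n (u ∘ suc) f))
    (+-comm (sum (applyUpTo (λ c → f (suc c) * (n C c)) (suc n))) (sum (applyUpTo (λ c → f c * (n C c)) (suc n))))

isYes-true : ∀ {P : Set} (P? : Dec P) → P → ⌊ P? ⌋ ≡ true
isYes-true P? p = trans (isYes≗does P?) (dec-true P? p)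

isYes-false : ∀ {P : Set} (P? : Dec P) → ¬ P → ⌊ P? ⌋ ≡ false
isYes-false P? ¬p = trans (isYes≗does P?) (dec-false P? ¬p)

sum-delta : ∀ n (f : ℕ → ℕ) k →
            sum (applyUpTo (λ c → bit (does (n ∸ c ≟ k)) * f c) n) ≡ (if ⌊ 1 ≤? k ⌋ ∧ ⌊ k ≤? n ⌋ then f (n ∸ k) else 0)
sum-delta zero    f zero    = refl
sum-delta zero    f (suc k) = refl
sum-delta (suc n) f zero    = sum-delta n (f ∘ suc) zero
sum-delta (suc n) f (suc k) rewrite sum-delta n (f ∘ suc) (suc k) with <-cmp k n
... | tri< k<n _ _ rewrite dec-false (n ≟ k) (>⇒≢ k<n) | isYes-true (suc k ≤? n) k<n | isYes-true (suc k ≤? suc n) (s≤s (<⇒≤ k<n)) =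
  cong f (sym (+-∸-assoc 1 k<n))
... | tri≈ _ refl _ rewrite dec-true (k ≟ k) refl | isYes-false (suc k ≤? k) (n≮n k) | isYes-true (suc k ≤? suc k) ≤-refl =
  trans (+-identityʳ (f 0 + 0)) (trans (+-identityʳ (f 0)) (cong f (sym (n∸n≡0 k))))
... | tri> _ _ k>n rewrite dec-false (n ≟ k) (<⇒≢ k>n) | isYes-false (suc k ≤? n) (<⇒≱ (m<n⇒m<1+n k>n))
                        | isYes-false (suc k ≤? suc n) (<⇒≱ (s≤s k>n)) = refl

bit-≟≡indicator : ∀ a b → bit (does (a ≟ b)) * 1 ≡ indicator b a
bit-≟≡indicator a b with b ≟ a
... | yes b≡a = cong (λ x → bit x * 1) (dec-true  (a ≟ b) (sym b≡a))
... | no  b≢a = cong (λ x → bit x * 1) (dec-false (a ≟ b) (b≢a ∘ sym))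

untwisted-coefficient : ∀ n k → bit (does (n ∸ n % 2 ≟ k)) * 1 ≡ (if ⌊ n % 2 ≟ 0 ⌋ then indicator k n else indicator k (n ∸ 1))
untwisted-coefficient n k with n % 2 | m%n<n n 2
... | 0           | _             = bit-≟≡indicator n k
... | 1           | _             = bit-≟≡indicator (n ∸ 1) k
... | suc (suc _) | s≤s (s≤s ())

twisted-coefficients : ∀ n k → sum (applyUpTo (λ c → bit (does (n ∸ c ≟ k)) * (n C suc c)) n)
                                 ≡ (if ⌊ 1 ≤? k ⌋ ∧ ⌊ k ≤? n ⌋ then n C (n + 1 ∸ k) else 0)
twisted-coefficients n k = trans (sum-delta n (λ c → n C suc c) k) (binomial-index (⌊ 1 ≤? k ⌋ ∧ ⌊ k ≤? n ⌋) refl)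
  where
  binomial-index : ∀ b → b ≡ ⌊ 1 ≤? k ⌋ ∧ ⌊ k ≤? n ⌋ →
                   (if b then n C suc (n ∸ k) else 0) ≡ (if b then n C (n + 1 ∸ k) else 0)
  binomial-index false _ = refl
  binomial-index true  b≡ = cong (n C_) (trans (+-comm 1 (n ∸ k)) (sym (+-∸-comm 1 k≤n)))
    where
    k≤n : k ≤ n
    k≤n = witness (k ≤? n) (trans (sym (isYes≗does (k ≤? n))) (proj₂ (∧-true⁻ (sym b≡))))

-- The hypothesis 2 ≤ n only excludes n = 0, where the model of the vertex boundary has no corners.
theorem3p9 : (n : ℕ) → 2 ≤ n → (B : Bouquet n) → IntersectionGraphComplete B →
    ∀ (k : ℕ) → partialPetrialCoeff B k ≡ rhsCoeff n k
theorem3p9 (suc m) _ B complete k = begin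
  partialPetrialCoeff B k
    ≡⟨ length-filter≡count (λ A → eulerGenus B (petrialTwist B A) ≟ k) (allSubsets n) ⟩
  count (λ A → does (eulerGenus B (petrialTwist B A) ≟ k)) (allSubsets n)
    ≡⟨ count-cong (λ A → cong (λ f → genus≟k ((2 * 1 + n) ∸ (1 + f))) (Faces.faces-complete (petrialTwist B A))) (allSubsets n) ⟩
  count (λ A → genus≟k (genusOf (count (petrialTwist B A) (allFin n)))) (allSubsets n)
    ≡⟨ sum-subsets n (twist B) (bit ∘ genus≟k ∘ genusOf) ⟩
  sum (applyUpTo (λ c → bit (genus≟k (genusOf c)) * (n C c)) (suc n))
    ≡⟨ cong₂ _+_ (untwisted-coefficient n k) (twisted-coefficients n k) ⟩
  rhsCoeff n k ∎
  where
  open CompleteBouquet B complete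
  open ≡-Reasoning
  genus≟k : ℕ → Bool
  genus≟k g = does (g ≟ k)
  genusOf : ℕ → ℕ
  genusOf c = (2 * 1 + n) ∸ (1 + faceCount n c)
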